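{- The bilinear operation $\star$ on $\bigoplus_{n\ge1}K\widehat{\mathbb{N}}^n$ defined on basis elements $\vec v\in\widehat{\mathbb{N}}^n$, $\vec w\in\widehat{\mathbb{N}}^m$ by $$\vec v\star\vec w:=\sum_{\vec t\in\widehat{\mathbb{N}}^{n+m},\ \vec v\nearrow\vec w\leq\vec t\leq\vec v\nwarrow\vec w}\vec t$$ is associative. Moreover, for all $\vec u,\vec v,\vec w$ (names of trees of positive degree), $$\vec u\star\vec v\star\vec w=\sum_{\vec u\nearrow\vec v\nearrow\vec w\leq\vec t\leq\vec u\nwarrow\vec v\nwarrow\vec w}\vec t,$$ and, extending $\star$ by the same formula to the name $(0)$ of the one-leaf tree, $\vec v\star(0)=\vec v=(0)\star\vec v$.
   Context: $K$ is a field of characteristic zero. $Y_n$ is the set of planar rooted binary trees with $n$ internal vertices, identified with complete parenthesizations of $x_1\cdots x_{n+1}$. The name of $\tau\in Y_n$ ($n\ge1$) is $(v_1,\ldots,v_n)$: $v_i=i$ if $x_i$ is immediately preceded by a left parenthesis; otherwise $x_i$ is immediately followed by a nonempty block of right parentheses and $v_i=j$ where $x_j$ is the first variable after the left parenthesis matched with the last right parenthesis of that block; the one-leaf tree has name $(0)$. $\widehat{\mathbb{N}}^n$ is the set of names of trees in $Y_n$, ordered componentwise. For $\vec v\in\widehat{\mathbb{N}}^n,\vec w\in\widehat{\mathbb{N}}^m$ ($n,m\ge1$): $\vec v\nearrow\vec w:=(\vec v,n\triangleright\vec w)$, $\vec v\nwarrow\vec w:=(\vec v,w_1+n,\ldots,w_m+n)$,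 where $n\triangleright\vec w:=(n\tilde+w_1,\ldots,n\tilde+w_m)$, $n\tilde+1:=1$, $n\tilde+a:=n+a$ ($a\ne1$); $(0)$ is a two-sided unit for $\nearrow$ and $\nwarrow$. Both operations are associative. -}

module Defs where

open import Level using (Level; _⊔_)
open import Data.Nat using (ℕ; zero; suc; _+_; _≤_; _≟_)
open import Data.Nat.Properties using (_≤?_)
open import Data.List using (List; []; _∷_; _++_; [_]; map; concat; concatMap; zipWith; filter; deduplicate; length; replicate; upTo)
open import Data.List.Properties using (≡-dec)
open import Data.List.Relation.Binary.Pointwise using (Pointwise)
import Data.List.Relation.Binary.Pointwise.Properties as PW
open import Data.List.Relation.Unary.All using (All)
open import Data.Vec using (Vec; head; toList) renaming (_∷_ to _∷ᵥ_; [] to []ᵥ; reverse to reverseᵥ; zipWith to zipWithᵥ)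
open import Data.Maybe using (Maybe; just; nothing; fromMaybe)
open import Data.Product using (Σ; _×_; _,_; proj₁; proj₂; ∃-syntax)
open import Relation.Nullary using (¬_; yes; no)
open import Relation.Nullary.Decidable using (_×-dec_)
open import Relation.Binary.PropositionalEquality using (_≡_)
open import Relation.Binary.Definitions using (Decidable)
open import Algebra.Bundles using (CommutativeRing)
import Algebra.Definitions.RawMonoid as RM

data Tree : Set where
  leaf : Tree
  node : Tree → Tree → Tree

internal : Tree → ℕ
internal leaf       = 0
internal (node l r) = suc (internal l + internal r)

leaves : Tree → ℕ
leaves leaf       = 1
leaves (node l r) = leaves l + leaves r

-- All trees of sizes n, n-1, ..., 0 (in this order).
allTrees : (n : ℕ) → Vec (List Tree) (suc n)
allTrees zero    = (leaf ∷ []) ∷ᵥ []ᵥ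
allTrees (suc n) = new ∷ᵥ prev
  where
  prev = allTrees n
  new  = concat (toList (zipWithᵥ (λ A B → concatMap (λ l → map (node l) B) A)
                                   prev (reverseᵥ prev)))

Y : ℕ → List Tree
Y n = head (allTrees n)

-- Trees as complete parenthesizations of x_1 ... x_{n+1}

data Tok : Set where
  lp  : Tok
  rp  : Tok
  var : ℕ → Tok

-- tokens of a tree whose leftmost variable is x_k
toksFrom : ℕ → Tree → List Tok
toksFrom k leaf       = var k ∷ []
toksFrom k (node l r) = lp ∷ (toksFrom k l ++ (toksFrom (k + leaves l) r ++ (rp ∷ [])))

toks : Tree → List Tok
toks τ = toksFrom 1 τ

rpBlock : List Tok → ℕ
rpBlock (rp ∷ ts) = suc (rpBlock ts)
rpBlock _         = 0

-- Scan a REVERSED token list starting just before (to the left of) a right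
-- parenthesis, at depth d (d = 1 initially); return the index of the first
-- variable after the matching left parenthesis (= last variable seen).
matchBack : ℕ → Maybe ℕ → List Tok → Maybe ℕ
matchBack d       seen []            = nothing
matchBack d       seen (rp ∷ ts)     = matchBack (suc d) seen ts
matchBack (suc zero) seen (lp ∷ ts)  = seen
matchBack (suc (suc d)) seen (lp ∷ ts) = matchBack (suc d) seen ts
matchBack zero    seen (lp ∷ ts)     = nothing
matchBack d       seen (var j ∷ ts)  = matchBack d (just j) ts

-- Value v_i given the reversed prefix before x_i and the suffix after x_i.
decideEntry : ℕ → List Tok → List Tok → Maybe ℕ
decideEntry i (lp ∷ _) post = just i
decideEntry i revPre   post with rpBlock post
... | zero  = nothing
... | suc k = matchBack 1 nothing (replicate k rp ++ (var i ∷ revPre))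

entryAux : ℕ → List Tok → List Tok → Maybe ℕ
entryAux i revPre []             = nothing
entryAux i revPre (lp ∷ ts)      = entryAux i (lp ∷ revPre) ts
entryAux i revPre (rp ∷ ts)      = entryAux i (rp ∷ revPre) ts
entryAux i revPre (var j ∷ ts) with j ≟ i
... | yes _ = decideEntry i revPre ts
... | no  _ = entryAux i (var j ∷ revPre) ts

-- The name (v_1,...,v_n) of a tree; the one-leaf tree has name (0).
-- (entryAux always succeeds on trees; the default 0 is never used.)
name : Tree → List ℕ
name leaf = 0 ∷ []
name (node l r) = map (λ i → fromMaybe 0 (entryAux i [] (toks (node l r))))
                      (map suc (upTo (internal (node l r))))

Nhat : ℕ → List (List ℕ)
Nhat n = deduplicate (≡-dec _≟_) (map name (Y n))

PosName : List ℕ → Set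
PosName v = Σ Tree λ τ → (1 ≤ internal τ) × (name τ ≡ v)

deg : List ℕ → ℕ
deg (0 ∷ []) = 0
deg v        = length v

_+̃_ : ℕ → ℕ → ℕ
n +̃ 1 = 1
n +̃ a = n + a

_↗_ : List ℕ → List ℕ → List ℕ
(0 ∷ []) ↗ w = w
v ↗ (0 ∷ []) = v
v ↗ w        = v ++ map (length v +̃_) w

_↖_ : List ℕ → List ℕ → List ℕ
(0 ∷ []) ↖ w = w
v ↖ (0 ∷ []) = v
v ↖ w        = v ++ map (_+ length v) w

_≤⃗_ : List ℕ → List ℕ → Set
_≤⃗_ = Pointwise _≤_

_≤⃗?_ : Decidable _≤⃗_
_≤⃗?_ = PW.decidable _≤?_

interval : ℕ → List ℕ → List ℕ → List (List ℕ)
interval d lo hi = filter (λ t → (lo ≤⃗? t) ×-dec (t ≤⃗? hi)) (Nhat d)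

starB : List ℕ → List ℕ → List (List ℕ)
starB v w = interval (deg v + deg w) (v ↗ w) (v ↖ w)

-- Free K-module on names: formal finite linear combinations, compared by
-- coefficients.

module FreeModule {c ℓ : Level} (K : CommutativeRing c ℓ) where
  open CommutativeRing K renaming (_+_ to _+K_; _*_ to _*K_)

  Comb : Set c
  Comb = List (Carrier × List ℕ)

  coeff : Comb → List ℕ → Carrier
  coeff []            t = 0#
  coeff ((a , s) ∷ x) t with ≡-dec _≟_ s t
  ... | yes _ = a +K coeff x t
  ... | no  _ = coeff x t

  _≋_ : Comb → Comb → Set ℓ
  x ≋ y = ∀ t → coeff x t ≈ coeff y t

  sumB : List (List ℕ) → Comb
  sumB ts = map (λ t → (1# , t)) ts

  basis : List ℕ → Comb
  basis v = (1# , v) ∷ []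

  _⋆_ : Comb → Comb → Comb
  x ⋆ y = concatMap (λ { (a , v) → concatMap (λ { (b , w) →
            map (λ t → (a *K b , t)) (starB v w) }) y }) x

  -- elements of ⊕_{n≥1} K N̂^n
  InSpace : Comb → Set c
  InSpace x = All (λ p → PosName (proj₂ p)) x

IsCharZeroField : {c ℓ : Level} → CommutativeRing c ℓ → Set (c ⊔ ℓ)
IsCharZeroField K =
  (¬ (1# ≈ 0#))
  × (∀ x → ¬ (x ≈ 0#) → ∃[ y ] (x * y ≈ 1#))
  × (∀ n → (n ·1 1#) ≈ 0# → n ≡ 0)
  where
  open CommutativeRing K hiding (_+_)
  open RM +-rawMonoid using () renaming (_×_ to _·1_)

{-# OPTIONS --safe #-}
module Submission where

-- Every name s in u ⋆ v is the name of a tree with deg u + deg v internal vertices,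
-- so the coefficient of t in (u ⋆ v) ⋆ w counts the names s with u ↗ v ≤ s ≤ u ↖ v
-- and s ↗ w ≤ t ≤ s ↖ w.  Both bounds on t begin with s, so only the prefix s of t
-- can contribute, and it does exactly when (u ↗ v) ↗ w ≤ t ≤ (u ↖ v) ↖ w, because a
-- prefix of a name is the name of the tree induced on the first leaves.  Dually, in
-- u ⋆ (v ⋆ w) only s = max (n + 1, y) − n (entrywise, for the tail y of t after
-- n = deg u entries) can contribute: this map inverts both n ▷_ and the shift by n,
-- and turns the tail of a name into the name of the tree induced on the last leaves.
-- So both triple products on basis elements are the same interval sum, bilinearity
-- gives associativity, and the unit laws hold because the interval [v, v] is {v}.

open import Defs
open import Level using (Level; 0ℓ)
open import Algebra.Bundles using (CommutativeRing)
open import Data.Nat using (ℕ; zero; suc; _+_; _*_; _∸_; _⊔_; _≤_; _<_; _≟_; z≤n; s≤s; s≤s⁻¹)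
open import Data.Nat.Properties
  using (_≤?_; +-assoc; +-comm; +-suc; +-identityʳ; +-cancelʳ-≡; +-cancelˡ-≤; +-monoʳ-≤; +-monoˡ-≤; +-commutativeSemigroup;
         suc-injective; m+1+n≰m; m+[n∸m]≡n; m+n∸m≡n; m+n∸n≡m; m∸n+n≡m; m≤m+n; m≤n+m; ∸-monoˡ-≤;
         m≤n⇒m⊔n≡n; m≥n⇒m⊔n≡m; m≤m⊔n; m≤n⊔m; ⊔-monoʳ-≤; n≤1+n; ≤-antisym; ≤-refl; ≤-reflexive; ≤-trans; ≰⇒>)
open import Data.List
  using (List; []; _∷_; _++_; map; concat; concatMap; filter; deduplicate; length; replicate; take; drop; head; upTo; applyUpTo)
open import Data.Nat.ListAction using (sum)
open import Algebra.Properties.CommutativeSemigroup +-commutativeSemigroup using (xy∙z≈xz∙y; x∙yz≈y∙xz)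
open import Data.List.Properties
  using (≡-dec; map-++; ++-assoc; ++-identityʳ; length-++; length-map; map-cong; map-cong-local; map-id-local; map-∘; map-upTo;
         take++drop≡id)
open import Data.List.Relation.Unary.All.Properties using (drop⁺; ++⁺; map⁺)
open import Data.List.Relation.Binary.Pointwise as Pointwise using (Pointwise; []; _∷_; Pointwise-≡⇒≡)
open import Data.List.Relation.Binary.Pointwise.Properties using (antisymmetric; transitive)
import Data.List.Relation.Binary.Pointwise.Properties as Pointwiseₚ
open import Data.List.Relation.Unary.All as All using (All; []; _∷_)
open import Data.List.Relation.Unary.Any using (here; there)
open import Data.List.Membership.Propositional using (_∈_)
open import Data.List.Membership.Propositional.Properties
  using (∈-concat⁻′; ∈-concat⁺′; ∈-map⁻; ∈-map⁺; ∈-filter⁻; ∈-deduplicate⁻)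
open import Data.Vec as V using (Vec; lookup; toList)
open import Data.Vec.Properties using (reverse-∷; map-reverse; lookup-map; lookup-zipWith)
open import Data.Vec.Membership.Propositional.Properties using (∈-lookup; ∈-toList⁺; ∈-toList⁻)
open import Data.Vec.Relation.Unary.Any using (index)
open import Data.Vec.Relation.Unary.Any.Properties using (lookup-index)
open import Data.Fin as Fin using (Fin; toℕ; fromℕ<)
open import Data.Fin.Properties using (toℕ<n; toℕ-fromℕ<)
open import Data.Maybe using (just; nothing; fromMaybe)
open import Data.Product using (∃; ∃₂; _×_; _,_; proj₁; proj₂; map₁)
open import Data.Empty using (⊥-elim)
open import Data.Sum using (_⊎_; inj₁; inj₂)
open import Function using (_∘_)
open import Relation.Nullary using (¬_; yes; no)
open import Relation.Nullary.Decidable using (_×-dec_)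
open import Relation.Unary using (Pred; Decidable)
open import Relation.Binary.PropositionalEquality
open ≡-Reasoning

-- Names of trees

-- nameFrom k τ is the name of τ when its leftmost leaf is x_k.  The entry of the
-- last variable of l is k: either l is a leaf and x_k follows a left parenthesis,
-- or its block of right parentheses ends with the one closing l.
nameFrom : ℕ → Tree → List ℕ
nameFrom k leaf       = []
nameFrom k (node l r) = nameFrom k l ++ k ∷ nameFrom (k + leaves l) r

leaves≡suc-internal : ∀ τ → leaves τ ≡ suc (internal τ)
leaves≡suc-internal leaf       = refl
leaves≡suc-internal (node l r) rewrite leaves≡suc-internal l | leaves≡suc-internal r =
  cong suc (+-suc (internal l) (internal r))

lastVar-node : ∀ k l r → k + leaves l + internal r ≡ k + internal (node l r)
lastVar-node k l r = begin
  k + leaves l + internal r          ≡⟨ cong (λ n → k + n + internal r) (leaves≡suc-internal l) ⟩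
  k + suc (internal l) + internal r  ≡⟨ +-assoc k _ _ ⟩
  k + internal (node l r)            ∎

toksFrom-node-++ : ∀ k l r rest →
  (toksFrom k l ++ (toksFrom (k + leaves l) r ++ rp ∷ [])) ++ rest
    ≡ toksFrom k l ++ (toksFrom (k + leaves l) r ++ rp ∷ rest)
toksFrom-node-++ k l r rest =
  trans (++-assoc (toksFrom k l) _ rest) (cong (toksFrom k l ++_) (++-assoc (toksFrom (k + leaves l) r) _ rest))

-- reverse (toksFrom k τ) ++ acc: the accumulator of entryAux once it has scanned τ
revToksOnto : ℕ → Tree → List Tok → List Tok
revToksOnto k leaf       acc = var k ∷ acc
revToksOnto k (node l r) acc = rp ∷ revToksOnto (k + leaves l) r (revToksOnto k l (lp ∷ acc))

rightSpine : Tree → ℕ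
rightSpine leaf       = 0
rightSpine (node l r) = suc (rightSpine r)

beforeLastVar : ℕ → Tree → List Tok → List Tok
beforeLastVar k leaf       pre = pre
beforeLastVar k (node l r) pre = beforeLastVar (k + leaves l) r (revToksOnto k l (lp ∷ pre))

revToksOnto-shape : ∀ τ k pre →
  revToksOnto k τ pre ≡ replicate (rightSpine τ) rp ++ var (k + internal τ) ∷ beforeLastVar k τ pre
revToksOnto-shape leaf       k pre = cong (λ i → var i ∷ pre) (sym (+-identityʳ k))
revToksOnto-shape (node l r) k pre =
  cong (rp ∷_) (trans (revToksOnto-shape r (k + leaves l) (revToksOnto k l (lp ∷ pre)))
    (cong (λ i → replicate (rightSpine r) rp ++ var i ∷ beforeLastVar k (node l r) pre) (lastVar-node k l r)))

revToksOnto-head : ∀ k τ acc → head (revToksOnto k τ acc) ≢ just lp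
revToksOnto-head k leaf       acc ()
revToksOnto-head k (node l r) acc ()

beforeLastVar-head : ∀ k τ pre → head pre ≢ just lp → head (beforeLastVar k τ pre) ≢ just lp
beforeLastVar-head k leaf       pre noLp = noLp
beforeLastVar-head k (node l r) pre _    =
  beforeLastVar-head (k + leaves l) r _ (revToksOnto-head k l (lp ∷ pre))

rpBlock-replicate : ∀ s rest → rpBlock (replicate s rp ++ rest) ≡ s + rpBlock rest
rpBlock-replicate zero    rest = refl
rpBlock-replicate (suc s) rest = cong suc (rpBlock-replicate s rest)

rpBlock-toksFrom : ∀ k τ rest → rpBlock (toksFrom k τ ++ rest) ≡ 0
rpBlock-toksFrom k leaf       rest = refl
rpBlock-toksFrom k (node l r) rest = refl

replicate-++-∷ : ∀ {A : Set} s (x : A) xs → replicate s x ++ x ∷ xs ≡ x ∷ replicate s x ++ xs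
replicate-++-∷ zero    x xs = refl
replicate-++-∷ (suc s) x xs = cong (x ∷_) (replicate-++-∷ s x xs)

entryAux-past : ∀ τ k pre rest i → k + leaves τ ≤ i →
  entryAux i pre (toksFrom k τ ++ rest) ≡ entryAux i (revToksOnto k τ pre) rest
entryAux-past leaf k pre rest i k<i with k ≟ i
... | yes refl = ⊥-elim (m+1+n≰m k k<i)
... | no _     = refl
entryAux-past (node l r) k pre rest i bound = begin
  entryAux i (lp ∷ pre) ((toksFrom k l ++ (toksFrom k′ r ++ rp ∷ [])) ++ rest)
    ≡⟨ cong (entryAux i (lp ∷ pre)) (toksFrom-node-++ k l r rest) ⟩
  entryAux i (lp ∷ pre) (toksFrom k l ++ (toksFrom k′ r ++ rp ∷ rest))
    ≡⟨ entryAux-past l k (lp ∷ pre) _ i (≤-trans (m≤m+n (k + leaves l) (leaves r)) bound′) ⟩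
  entryAux i (revToksOnto k l (lp ∷ pre)) (toksFrom k′ r ++ rp ∷ rest)
    ≡⟨ entryAux-past r k′ _ (rp ∷ rest) i bound′ ⟩
  entryAux i (revToksOnto k (node l r) pre) rest ∎
  where
  k′ = k + leaves l
  bound′ : k′ + leaves r ≤ i
  bound′ = subst (_≤ i) (sym (+-assoc k (leaves l) (leaves r))) bound

entryAux-lastVar : ∀ τ k pre post i → i ≡ k + internal τ →
  entryAux i pre (toksFrom k τ ++ post) ≡ decideEntry i (beforeLastVar k τ pre) (replicate (rightSpine τ) rp ++ post)
entryAux-lastVar leaf k pre post i i≡k with k ≟ i
... | yes _  = refl
... | no k≢i = ⊥-elim (k≢i (sym (trans i≡k (+-identityʳ k))))
entryAux-lastVar (node l r) k pre post i i≡last = begin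
  entryAux i (lp ∷ pre) ((toksFrom k l ++ (toksFrom k′ r ++ rp ∷ [])) ++ post)
    ≡⟨ cong (entryAux i (lp ∷ pre)) (toksFrom-node-++ k l r post) ⟩
  entryAux i (lp ∷ pre) (toksFrom k l ++ (toksFrom k′ r ++ rp ∷ post))
    ≡⟨ entryAux-past l k (lp ∷ pre) _ i (≤-trans (m≤m+n k′ (internal r)) (≤-reflexive (sym i≡last′))) ⟩
  entryAux i (revToksOnto k l (lp ∷ pre)) (toksFrom k′ r ++ rp ∷ post)
    ≡⟨ entryAux-lastVar r k′ _ (rp ∷ post) i i≡last′ ⟩
  decideEntry i P (replicate (rightSpine r) rp ++ rp ∷ post)
    ≡⟨ cong (decideEntry i P) (replicate-++-∷ (rightSpine r) rp post) ⟩
  decideEntry i P (rp ∷ replicate (rightSpine r) rp ++ post) ∎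
  where
  k′ = k + leaves l
  P  = beforeLastVar k (node l r) pre
  i≡last′ : i ≡ k′ + internal r
  i≡last′ = trans i≡last (sym (lastVar-node k l r))

-- Scanning backwards across a whole subtree returns to the same depth, having
-- last seen its leftmost variable.
matchBack-revToksOnto : ∀ τ k d seen rest →
  matchBack (suc d) seen (revToksOnto k τ rest) ≡ matchBack (suc d) (just k) rest
matchBack-revToksOnto leaf       k d seen rest = refl
matchBack-revToksOnto (node l r) k d seen rest =
  trans (matchBack-revToksOnto r (k + leaves l) (suc d) seen _)
        (matchBack-revToksOnto l k (suc d) (just (k + leaves l)) (lp ∷ rest))

decideEntry-notAfterLp : ∀ i revPre post s → head revPre ≢ just lp → rpBlock post ≡ suc s →
  decideEntry i revPre post ≡ matchBack 1 nothing (replicate s rp ++ var i ∷ revPre)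
decideEntry-notAfterLp i []          post s _   block rewrite block = refl
decideEntry-notAfterLp i (lp ∷ _)    post s ¬lp _     = ⊥-elim (¬lp refl)
decideEntry-notAfterLp i (rp ∷ _)    post s _   block rewrite block = refl
decideEntry-notAfterLp i (var _ ∷ _) post s _   block rewrite block = refl

entryAux-lastVar-node : ∀ l r k pre post i → i ≡ k + internal (node l r) → rpBlock post ≡ 0 →
  entryAux i pre (toksFrom k (node l r) ++ post) ≡ just k
entryAux-lastVar-node l r k pre post i i≡last noRp = begin
  entryAux i pre (toksFrom k τ ++ post)
    ≡⟨ entryAux-lastVar τ k pre post i i≡last ⟩
  decideEntry i P (rp ∷ replicate s rp ++ post)
    ≡⟨ decideEntry-notAfterLp i P _ s (beforeLastVar-head k′ r _ (revToksOnto-head k l (lp ∷ pre))) block ⟩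
  matchBack 1 nothing (replicate s rp ++ var i ∷ P)
    ≡⟨ cong (matchBack 1 nothing) (trans (revToksOnto-shape r k′ _) (cong (λ j → replicate s rp ++ var j ∷ P) lastVar)) ⟨
  matchBack 1 nothing (revToksOnto k′ r (revToksOnto k l (lp ∷ pre)))
    ≡⟨ matchBack-revToksOnto r k′ 0 nothing _ ⟩
  matchBack 1 (just k′) (revToksOnto k l (lp ∷ pre))
    ≡⟨ matchBack-revToksOnto l k 0 (just k′) (lp ∷ pre) ⟩
  just k ∎
  where
  τ  = node l r
  k′ = k + leaves l
  s  = rightSpine r
  P  = beforeLastVar k τ pre
  lastVar : k′ + internal r ≡ i
  lastVar = trans (lastVar-node k l r) (sym i≡last)
  block : rpBlock (rp ∷ replicate s rp ++ post) ≡ suc s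
  block = cong suc (trans (rpBlock-replicate s post) (trans (cong (s +_) noRp) (+-identityʳ s)))

entry : List Tok → List Tok → ℕ → ℕ
entry pre ts i = fromMaybe 0 (entryAux i pre ts)

entry-lastVar : ∀ τ k pre post → rpBlock post ≡ 0 → entry (lp ∷ pre) (toksFrom k τ ++ post) (k + internal τ) ≡ k
entry-lastVar leaf k pre post _ rewrite +-identityʳ k with k ≟ k
... | yes _  = refl
... | no k≢k = ⊥-elim (k≢k refl)
entry-lastVar (node l r) k pre post noRp =
  cong (fromMaybe 0) (entryAux-lastVar-node l r k (lp ∷ pre) post _ refl noRp)

range : ℕ → ℕ → List ℕ
range k zero    = []
range k (suc n) = k ∷ range (suc k) n

range-++ : ∀ k m n → range k (m + n) ≡ range k m ++ range (k + m) n
range-++ k zero    n = cong (λ j → range j n) (sym (+-identityʳ k))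
range-++ k (suc m) n =
  cong (k ∷_) (trans (range-++ (suc k) m n) (cong (λ j → range (suc k) m ++ range j n) (sym (+-suc k m))))

range-node : ∀ k l r →
  range k (internal (node l r)) ≡ range k (internal l) ++ (k + internal l) ∷ range (k + leaves l) (internal r)
range-node k l r = begin
  range k (suc (internal l + internal r))     ≡⟨ cong (range k) (sym (+-suc (internal l) (internal r))) ⟩
  range k (internal l + suc (internal r))     ≡⟨ range-++ k (internal l) (suc (internal r)) ⟩
  range k (internal l) ++ (k + internal l) ∷ range (suc (k + internal l)) (internal r)
    ≡⟨ cong (λ j → range k (internal l) ++ (k + internal l) ∷ range j (internal r)) leaves-l ⟩
  range k (internal l) ++ (k + internal l) ∷ range (k + leaves l) (internal r) ∎
  where
  leaves-l : suc (k + internal l) ≡ k + leaves l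
  leaves-l = trans (sym (+-suc k (internal l))) (cong (k +_) (sym (leaves≡suc-internal l)))

range-≥ : ∀ k n → All (k ≤_) (range k n)
range-≥ k zero    = []
range-≥ k (suc n) = ≤-refl ∷ All.map (≤-trans (n≤1+n k)) (range-≥ (suc k) n)

applyUpTo≡range : ∀ (f : ℕ → ℕ) k n → (∀ i → f i ≡ k + i) → applyUpTo f n ≡ range k n
applyUpTo≡range f k zero    f≡ = refl
applyUpTo≡range f k (suc n) f≡ =
  cong₂ _∷_ (trans (f≡ 0) (+-identityʳ k)) (applyUpTo≡range (f ∘ suc) (suc k) n (λ i → trans (f≡ (suc i)) (+-suc k i)))

entries-toksFrom : ∀ τ k pre post → map (entry pre (toksFrom k τ ++ post)) (range k (internal τ)) ≡ nameFrom k τ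
entries-toksFrom leaf       k pre post = refl
entries-toksFrom (node l r) k pre post = begin
  map f (range k (internal (node l r)))
    ≡⟨ cong (map f) (range-node k l r) ⟩
  map f (range k (internal l) ++ (k + internal l) ∷ range k′ (internal r))
    ≡⟨ map-++ f (range k (internal l)) _ ⟩
  map f (range k (internal l)) ++ f (k + internal l) ∷ map f (range k′ (internal r))
    ≡⟨ cong₂ _++_ inLeft (cong₂ _∷_ atJoin inRight) ⟩
  nameFrom k l ++ k ∷ nameFrom k′ r ∎
  where
  k′    = k + leaves l
  inner = toksFrom k′ r ++ rp ∷ post
  f     = entry pre (toksFrom k (node l r) ++ post)
  f≡ : ∀ i → f i ≡ entry (lp ∷ pre) (toksFrom k l ++ inner) i
  f≡ i = cong (λ ts → entry (lp ∷ pre) ts i) (toksFrom-node-++ k l r post)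
  inLeft : map f (range k (internal l)) ≡ nameFrom k l
  inLeft = trans (map-cong f≡ _) (entries-toksFrom l k (lp ∷ pre) inner)
  atJoin : f (k + internal l) ≡ k
  atJoin = trans (f≡ _) (entry-lastVar l k pre inner (rpBlock-toksFrom k′ r _))
  pastLeft : ∀ {i} → k′ ≤ i → f i ≡ entry (revToksOnto k l (lp ∷ pre)) (toksFrom k′ r ++ rp ∷ post) i
  pastLeft {i} k′≤i = trans (f≡ i) (cong (fromMaybe 0) (entryAux-past l k (lp ∷ pre) inner i k′≤i))
  inRight : map f (range k′ (internal r)) ≡ nameFrom k′ r
  inRight = trans (map-cong-local (All.map pastLeft (range-≥ k′ (internal r))))
                  (entries-toksFrom r k′ (revToksOnto k l (lp ∷ pre)) (rp ∷ post))

name≡nameFrom : ∀ τ → 1 ≤ internal τ → name τ ≡ nameFrom 1 τ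
name≡nameFrom (node l r) _ = begin
  map (entry [] (toks τ)) (map suc (upTo (internal τ)))
    ≡⟨ cong (map (entry [] (toks τ))) (trans (map-upTo suc (internal τ)) (applyUpTo≡range suc 1 _ (λ _ → refl))) ⟩
  map (entry [] (toks τ)) (range 1 (internal τ))
    ≡⟨ cong (λ ts → map (entry [] ts) (range 1 (internal τ))) (sym (++-identityʳ (toks τ))) ⟩
  map (entry [] (toks τ ++ [])) (range 1 (internal τ))
    ≡⟨ entries-toksFrom τ 1 [] [] ⟩
  nameFrom 1 τ ∎
  where τ = node l r

-- Enumeration of trees

grafts : List Tree → List Tree → List Tree
grafts A B = concatMap (λ l → map (node l) B) A

∈-grafts⁻ : ∀ A B {τ} → τ ∈ grafts A B → ∃₂ λ l r → τ ≡ node l r × l ∈ A × r ∈ B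
∈-grafts⁻ A B τ∈ with ∈-concat⁻′ (map (λ l → map (node l) B) A) τ∈
... | Ts , τ∈Ts , Ts∈ with ∈-map⁻ (λ l → map (node l) B) Ts∈
...   | l , l∈ , refl with ∈-map⁻ (node l) τ∈Ts
...     | r , r∈ , refl = l , r , refl , l∈ , r∈

∈-grafts-node⁻ : ∀ A B {l r} → node l r ∈ grafts A B → l ∈ A × r ∈ B
∈-grafts-node⁻ A B τ∈ with ∈-grafts⁻ A B τ∈
... | _ , _ , refl , l∈ , r∈ = l∈ , r∈

leaf∉grafts : ∀ A B → ¬ leaf ∈ grafts A B
leaf∉grafts A B τ∈ with ∈-grafts⁻ A B τ∈
... | _ , _ , () , _

∈-grafts⁺ : ∀ {A B l r} → l ∈ A → r ∈ B → node l r ∈ grafts A B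
∈-grafts⁺ {A} {B} l∈ r∈ = ∈-concat⁺′ (∈-map⁺ (node _) r∈) (∈-map⁺ (λ l → map (node l) B) l∈)

countdown : (n : ℕ) → Vec ℕ (suc n)
countdown zero    = 0 V.∷ V.[]
countdown (suc n) = suc n V.∷ countdown n

countFrom : ℕ → (n : ℕ) → Vec ℕ n
countFrom k zero    = V.[]
countFrom k (suc n) = k V.∷ countFrom (suc k) n

allTrees≡ : ∀ n → allTrees n ≡ V.map Y (countdown n)
allTrees≡ zero    = refl
allTrees≡ (suc n) = cong (Y (suc n) V.∷_) (allTrees≡ n)

countFrom-∷ʳ : ∀ k m → countFrom k m V.∷ʳ (k + m) ≡ countFrom k (suc m)
countFrom-∷ʳ k zero    = cong (V._∷ V.[]) (+-identityʳ k)
countFrom-∷ʳ k (suc m) =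
  cong (k V.∷_) (trans (cong (countFrom (suc k) m V.∷ʳ_) (+-suc k m)) (countFrom-∷ʳ (suc k) m))

reverse-countdown : ∀ n → V.reverse (countdown n) ≡ countFrom 0 (suc n)
reverse-countdown zero    = refl
reverse-countdown (suc n) = begin
  V.reverse (suc n V.∷ countdown n)    ≡⟨ reverse-∷ (suc n) (countdown n) ⟩
  V.reverse (countdown n) V.∷ʳ suc n   ≡⟨ cong (V._∷ʳ suc n) (reverse-countdown n) ⟩
  countFrom 0 (suc n) V.∷ʳ suc n       ≡⟨ countFrom-∷ʳ 0 (suc n) ⟩
  countFrom 0 (suc (suc n))            ∎

lookup-countdown : ∀ n (i : Fin (suc n)) → lookup (countdown n) i ≡ n ∸ toℕ i
lookup-countdown zero    Fin.zero    = refl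
lookup-countdown (suc n) Fin.zero    = refl
lookup-countdown (suc n) (Fin.suc i) = lookup-countdown n i

lookup-countFrom : ∀ k n (i : Fin n) → lookup (countFrom k n) i ≡ k + toℕ i
lookup-countFrom k (suc n) Fin.zero    = sym (+-identityʳ k)
lookup-countFrom k (suc n) (Fin.suc i) = trans (lookup-countFrom (suc k) n i) (sym (+-suc k (toℕ i)))

graftBlocks : (n : ℕ) → Vec (List Tree) (suc n)
graftBlocks n = V.zipWith grafts (V.map Y (countdown n)) (V.map Y (countFrom 0 (suc n)))

Y-suc : ∀ n → Y (suc n) ≡ concat (toList (graftBlocks n))
Y-suc n = begin
  concat (toList (V.zipWith grafts (allTrees n) (V.reverse (allTrees n))))
    ≡⟨ cong (λ T → concat (toList (V.zipWith grafts T (V.reverse T)))) (allTrees≡ n) ⟩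
  concat (toList (V.zipWith grafts (V.map Y (countdown n)) (V.reverse (V.map Y (countdown n)))))
    ≡⟨ cong (λ T → concat (toList (V.zipWith grafts (V.map Y (countdown n)) T)))
            (trans (sym (map-reverse Y (countdown n))) (cong (V.map Y) (reverse-countdown n))) ⟩
  concat (toList (graftBlocks n)) ∎

lookup-graftBlocks : ∀ n i → lookup (graftBlocks n) i ≡ grafts (Y (n ∸ toℕ i)) (Y (toℕ i))
lookup-graftBlocks n i =
  trans (lookup-zipWith grafts i (V.map Y (countdown n)) (V.map Y (countFrom 0 (suc n))))
        (cong₂ grafts (trans (lookup-map i Y (countdown n)) (cong Y (lookup-countdown n i)))
                      (trans (lookup-map i Y (countFrom 0 (suc n))) (cong Y (lookup-countFrom 0 (suc n) i))))

∈-graftBlocks⁻ : ∀ n {τ} → τ ∈ concat (toList (graftBlocks n)) →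
  ∃ λ (i : Fin (suc n)) → τ ∈ grafts (Y (n ∸ toℕ i)) (Y (toℕ i))
∈-graftBlocks⁻ n τ∈ with ∈-concat⁻′ (toList (graftBlocks n)) τ∈
... | Ts , τ∈Ts , Ts∈ = i , subst (_ ∈_) (trans (lookup-index Ts∈′) (lookup-graftBlocks n i)) τ∈Ts
  where
  Ts∈′ = ∈-toList⁻ Ts∈
  i    = index Ts∈′

∈Y-node⁻ : ∀ n {l r} → node l r ∈ Y (suc n) → ∃₂ λ a b → l ∈ Y a × r ∈ Y b × a + b ≡ n
∈Y-node⁻ n τ∈ = n ∸ toℕ i , toℕ i , proj₁ l∈,r∈ , proj₂ l∈,r∈ , m∸n+n≡m (s≤s⁻¹ (toℕ<n i))
  where
  i     = proj₁ (∈-graftBlocks⁻ n (subst (_ ∈_) (Y-suc n) τ∈))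
  l∈,r∈ = ∈-grafts-node⁻ (Y (n ∸ toℕ i)) (Y (toℕ i)) (proj₂ (∈-graftBlocks⁻ n (subst (_ ∈_) (Y-suc n) τ∈)))

leaf∉Y-suc : ∀ n → ¬ leaf ∈ Y (suc n)
leaf∉Y-suc n τ∈ with ∈-graftBlocks⁻ n (subst (_ ∈_) (Y-suc n) τ∈)
... | i , τ∈′ = leaf∉grafts (Y (n ∸ toℕ i)) (Y (toℕ i)) τ∈′

∈Y-node⁺ : ∀ a b {n l r} → l ∈ Y a → r ∈ Y b → a + b ≡ n → node l r ∈ Y (suc n)
∈Y-node⁺ a b {n} l∈ r∈ a+b≡n =
  subst (_ ∈_) (sym (Y-suc n))
    (∈-concat⁺′ (subst (_ ∈_) (sym block-i) (∈-grafts⁺ l∈ r∈)) (∈-toList⁺ (∈-lookup i (graftBlocks n))))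
  where
  b<1+n : b < suc n
  b<1+n = s≤s (subst (b ≤_) a+b≡n (m≤n+m b a))
  i = fromℕ< b<1+n
  block-i : lookup (graftBlocks n) i ≡ grafts (Y a) (Y b)
  block-i = trans (lookup-graftBlocks n i)
    (cong₂ (λ x y → grafts (Y x) (Y y))
      (trans (cong (n ∸_) (toℕ-fromℕ< b<1+n)) (trans (cong (_∸ b) (sym a+b≡n)) (m+n∸n≡m a b)))
      (toℕ-fromℕ< b<1+n))

∈Y⇒internal : ∀ {τ} n → τ ∈ Y n → internal τ ≡ n
∈Y⇒internal {leaf}     zero    _  = refl
∈Y⇒internal {node _ _} zero    (here ())
∈Y⇒internal {node _ _} zero    (there ())
∈Y⇒internal {leaf}     (suc n) τ∈ = ⊥-elim (leaf∉Y-suc n τ∈)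
∈Y⇒internal {node l r} (suc n) τ∈ = internal-node (∈Y-node⁻ n τ∈)
  where
  internal-node : (∃₂ λ a b → l ∈ Y a × r ∈ Y b × a + b ≡ n) → internal (node l r) ≡ suc n
  internal-node (a , b , l∈ , r∈ , a+b≡n) =
    cong suc (trans (cong₂ _+_ (∈Y⇒internal a l∈) (∈Y⇒internal b r∈)) a+b≡n)

∈Y-internal : ∀ τ → τ ∈ Y (internal τ)
∈Y-internal leaf       = here refl
∈Y-internal (node l r) = ∈Y-node⁺ (internal l) (internal r) (∈Y-internal l) (∈Y-internal r) refl

-- Counting names in intervals

count : List (List ℕ) → List ℕ → ℕ
count []      t = 0
count (s ∷ L) t with ≡-dec _≟_ s t
... | yes _ = suc (count L t)
... | no  _ = count L t

Indicator : ℕ → Set → Set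
Indicator c P = (c ≡ 1 × P) ⊎ (c ≡ 0 × ¬ P)

module _ {P : Pred (List ℕ) 0ℓ} (P? : Decidable P) where

  count-filter : ∀ L {t} → P t → count (filter P? L) t ≡ count L t
  count-filter []      _  = refl
  count-filter (s ∷ L) {t} pt with P? s
  ... | yes _ with ≡-dec _≟_ s t
  ...   | yes _ = cong suc (count-filter L pt)
  ...   | no  _ = count-filter L pt
  count-filter (s ∷ L) {t} pt | no ¬ps with ≡-dec _≟_ s t
  ...   | yes refl = ⊥-elim (¬ps pt)
  ...   | no  _    = count-filter L pt

  count-filter-¬ : ∀ L {t} → ¬ P t → count (filter P? L) t ≡ 0
  count-filter-¬ []      _   = refl
  count-filter-¬ (s ∷ L) {t} ¬pt with P? s
  ... | no _ = count-filter-¬ L ¬pt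
  ... | yes ps with ≡-dec _≟_ s t
  ...   | yes refl = ⊥-elim (¬pt ps)
  ...   | no  _    = count-filter-¬ L ¬pt

count-deduplicate : ∀ L t → Indicator (count (deduplicate (≡-dec _≟_) L) t) (t ∈ L)
count-deduplicate []      t = inj₂ (refl , λ ())
count-deduplicate (s ∷ L) t with ≡-dec _≟_ s t
... | yes refl = inj₁ (cong suc (count-filter-¬ _ (deduplicate (≡-dec _≟_) L) (λ s≢s → s≢s refl)) , here refl)
... | no s≢t with count-deduplicate L t
...   | inj₁ (c≡1 , t∈) = inj₁ (trans (count-filter _ (deduplicate (≡-dec _≟_) L) s≢t) c≡1 , there t∈)
...   | inj₂ (c≡0 , t∉) = inj₂ (trans (count-filter _ (deduplicate (≡-dec _≟_) L) s≢t) c≡0 ,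
                                λ { (here t≡s) → s≢t (sym t≡s) ; (there t∈) → t∉ t∈ })

indicator-* : ∀ {a b c P Q R} → Indicator a P → (P → Indicator b Q) → Indicator c R →
  (R → P × Q) → (P × Q → R) → a * b ≡ c
indicator-* (inj₂ (refl , _)) _ (inj₂ (refl , _)) _ _ = refl
indicator-* (inj₂ (_ , ¬p))   _ (inj₁ (_ , r))    to _ = ⊥-elim (¬p (proj₁ (to r)))
indicator-* (inj₁ (refl , p)) b? c? to from with b? p | c?
... | inj₁ (refl , _) | inj₁ (refl , _) = refl
... | inj₁ (_ , q)    | inj₂ (_ , ¬r)   = ⊥-elim (¬r (from (p , q)))
... | inj₂ (refl , _) | inj₂ (refl , _) = refl
... | inj₂ (_ , ¬q)   | inj₁ (_ , r)    = ⊥-elim (¬q (proj₂ (to r)))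

sum-map≡count* : ∀ (g : List ℕ → ℕ) s₀ L → (∀ {s} → s ∈ L → g s ≢ 0 → s ≡ s₀) →
  sum (map g L) ≡ count L s₀ * g s₀
sum-map≡count* g s₀ []      _      = refl
sum-map≡count* g s₀ (s ∷ L) unique with ≡-dec _≟_ s s₀
... | yes refl = cong (g s +_) (sum-map≡count* g s L (unique ∘ there))
... | no s≢s₀ with g s ≟ 0
...   | yes gs≡0 = trans (cong (_+ sum (map g L)) gs≡0) (sum-map≡count* g s₀ L (unique ∘ there))
...   | no gs≢0  = ⊥-elim (s≢s₀ (unique (here refl) gs≢0))

IsName : ℕ → List ℕ → Set
IsName d t = ∃ λ τ → internal τ ≡ d × nameFrom 1 τ ≡ t

∈names⇒IsName : ∀ {d t} → 1 ≤ d → t ∈ map name (Y d) → IsName d t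
∈names⇒IsName {d} 1≤d t∈ with ∈-map⁻ name t∈
... | τ , τ∈ , refl = τ , ∈Y⇒internal d τ∈ , sym (name≡nameFrom τ (subst (1 ≤_) (sym (∈Y⇒internal d τ∈)) 1≤d))

IsName⇒∈names : ∀ {d t} → 1 ≤ d → IsName d t → t ∈ map name (Y d)
IsName⇒∈names 1≤d (τ , refl , refl) =
  subst (_∈ map name (Y (internal τ))) (name≡nameFrom τ 1≤d) (∈-map⁺ name (∈Y-internal τ))

InInterval : ℕ → List ℕ → List ℕ → List ℕ → Set
InInterval d lo hi t = (lo ≤⃗ t × t ≤⃗ hi) × IsName d t

within? : (lo hi : List ℕ) → Decidable (λ t → lo ≤⃗ t × t ≤⃗ hi)
within? lo hi t = (lo ≤⃗? t) ×-dec (t ≤⃗? hi)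

count-interval : ∀ d lo hi t → 1 ≤ d → Indicator (count (interval d lo hi) t) (InInterval d lo hi t)
count-interval d lo hi t 1≤d with within? lo hi t
... | no ¬within = inj₂ (count-filter-¬ (within? lo hi) (Nhat d) ¬within , ¬within ∘ proj₁)
... | yes within with count-deduplicate (map name (Y d)) t
...   | inj₁ (c≡1 , t∈) =
  inj₁ (trans (count-filter (within? lo hi) (Nhat d) within) c≡1 , within , ∈names⇒IsName 1≤d t∈)
...   | inj₂ (c≡0 , t∉) =
  inj₂ (trans (count-filter (within? lo hi) (Nhat d) within) c≡0 , t∉ ∘ IsName⇒∈names 1≤d ∘ proj₂)

count≢0⇒InInterval : ∀ {d lo hi t} → 1 ≤ d → count (interval d lo hi) t ≢ 0 → InInterval d lo hi t
count≢0⇒InInterval {d} {lo} {hi} {t} 1≤d c≢0 with count-interval d lo hi t 1≤d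
... | inj₁ (_ , inside) = inside
... | inj₂ (c≡0 , _)    = ⊥-elim (c≢0 c≡0)

∈interval⇒IsName : ∀ {d lo hi t} → 1 ≤ d → t ∈ interval d lo hi → IsName d t
∈interval⇒IsName {d} {lo} {hi} 1≤d t∈ =
  ∈names⇒IsName 1≤d (∈-deduplicate⁻ (≡-dec _≟_) (map name (Y d)) (proj₁ (∈-filter⁻ (within? lo hi) t∈)))

-- Prefixes and suffixes of names

length-nameFrom : ∀ k τ → length (nameFrom k τ) ≡ internal τ
length-nameFrom k leaf       = refl
length-nameFrom k (node l r) = begin
  length (nameFrom k l ++ k ∷ nameFrom (k + leaves l) r)      ≡⟨ length-++ (nameFrom k l) ⟩
  length (nameFrom k l) + suc (length (nameFrom (k + leaves l) r))
    ≡⟨ cong₂ (λ a b → a + suc b) (length-nameFrom k l) (length-nameFrom (k + leaves l) r) ⟩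
  internal l + suc (internal r)                               ≡⟨ +-suc (internal l) (internal r) ⟩
  internal (node l r)                                         ∎

nameFrom-≥ : ∀ k τ → All (k ≤_) (nameFrom k τ)
nameFrom-≥ k leaf       = []
nameFrom-≥ k (node l r) =
  ++⁺ (nameFrom-≥ k l) (≤-refl ∷ All.map (≤-trans (m≤m+n k (leaves l))) (nameFrom-≥ (k + leaves l) r))

nameFrom-+ : ∀ j k τ → nameFrom (j + k) τ ≡ map (j +_) (nameFrom k τ)
nameFrom-+ j k leaf       = refl
nameFrom-+ j k (node l r) = begin
  nameFrom (j + k) l ++ (j + k) ∷ nameFrom (j + k + leaves l) r
    ≡⟨ cong₂ (λ a b → a ++ (j + k) ∷ b) (nameFrom-+ j k l)
             (trans (cong (λ i → nameFrom i r) (+-assoc j k (leaves l))) (nameFrom-+ j (k + leaves l) r)) ⟩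
  map (j +_) (nameFrom k l) ++ (j + k) ∷ map (j +_) (nameFrom (k + leaves l) r)
    ≡⟨ map-++ (j +_) (nameFrom k l) _ ⟨
  map (j +_) (nameFrom k (node l r)) ∎

take-++ˡ : ∀ {A : Set} n (xs ys : List A) → n ≤ length xs → take n (xs ++ ys) ≡ take n xs
take-++ˡ zero    xs       ys _         = refl
take-++ˡ (suc n) (x ∷ xs) ys (s≤s n≤) = cong (x ∷_) (take-++ˡ n xs ys n≤)

take-++ʳ : ∀ {A : Set} n (xs ys : List A) → take (length xs + n) (xs ++ ys) ≡ xs ++ take n ys
take-++ʳ n []       ys = refl
take-++ʳ n (x ∷ xs) ys = cong (x ∷_) (take-++ʳ n xs ys)

drop-++ˡ : ∀ {A : Set} n (xs ys : List A) → n ≤ length xs → drop n (xs ++ ys) ≡ drop n xs ++ ys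
drop-++ˡ zero    xs       ys _         = refl
drop-++ˡ (suc n) (x ∷ xs) ys (s≤s n≤) = drop-++ˡ n xs ys n≤

drop-++ʳ : ∀ {A : Set} n (xs ys : List A) → drop (length xs + n) (xs ++ ys) ≡ drop n ys
drop-++ʳ n []       ys = refl
drop-++ʳ n (x ∷ xs) ys = drop-++ʳ n xs ys

≤length-nameFrom : ∀ {N} k τ → N ≤ internal τ → N ≤ length (nameFrom k τ)
≤length-nameFrom k τ = subst (_ ≤_) (sym (length-nameFrom k τ))

leaves+≡internal+suc : ∀ l m → leaves l + m ≡ internal l + suc m
leaves+≡internal+suc l m = trans (cong (_+ m) (leaves≡suc-internal l)) (sym (+-suc (internal l) m))

beyondLeft : ∀ {N} l r → ¬ N ≤ internal l → N ≤ internal (node l r) →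
  leaves l + (N ∸ leaves l) ≡ N × N ∸ leaves l ≤ internal r
beyondLeft {N} l r N≰ N≤ = m+[n∸m]≡n leaves≤N , N′≤
  where
  leaves≤N : leaves l ≤ N
  leaves≤N = subst (_≤ N) (sym (leaves≡suc-internal l)) (≰⇒> N≰)
  N′≤ : N ∸ leaves l ≤ internal r
  N′≤ = +-cancelˡ-≤ (leaves l) _ _
    (subst₂ _≤_ (sym (m+[n∸m]≡n leaves≤N)) (cong (_+ internal r) (sym (leaves≡suc-internal l))) N≤)

-- the tree that τ induces on its first N + 1 leaves
prefixTree : ℕ → Tree → Tree
prefixTree N leaf = leaf
prefixTree N (node l r) with N ≤? internal l
... | yes _ = prefixTree N l
... | no  _ = node l (prefixTree (N ∸ leaves l) r)

internal-prefixTree : ∀ N τ → N ≤ internal τ → internal (prefixTree N τ) ≡ N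
internal-prefixTree zero leaf _ = refl
internal-prefixTree N (node l r) N≤ with N ≤? internal l
... | yes N≤l = internal-prefixTree N l N≤l
... | no  N≰l = begin
  suc (internal l + internal (prefixTree N′ r)) ≡⟨ cong (λ i → suc (internal l + i)) (internal-prefixTree N′ r N′≤) ⟩
  suc (internal l + N′)                        ≡⟨ +-suc (internal l) N′ ⟨
  internal l + suc N′                          ≡⟨ N≡ ⟨
  N ∎
  where
  N′ = N ∸ leaves l
  N≡ = trans (sym (proj₁ (beyondLeft l r N≰l N≤))) (leaves+≡internal+suc l N′)
  N′≤ = proj₂ (beyondLeft l r N≰l N≤)

take-nameFrom : ∀ N k τ → N ≤ internal τ → take N (nameFrom k τ) ≡ nameFrom k (prefixTree N τ)
take-nameFrom zero k leaf _ = refl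
take-nameFrom N k (node l r) N≤ with N ≤? internal l
... | yes N≤l = trans (take-++ˡ N (nameFrom k l) _ (≤length-nameFrom k l N≤l)) (take-nameFrom N k l N≤l)
... | no  N≰l = begin
  take N (nameFrom k l ++ k ∷ nameFrom k′ r)
    ≡⟨ cong (λ n → take n (nameFrom k l ++ k ∷ nameFrom k′ r))
            (trans N≡ (cong (_+ suc N′) (sym (length-nameFrom k l)))) ⟩
  take (length (nameFrom k l) + suc N′) (nameFrom k l ++ k ∷ nameFrom k′ r)
    ≡⟨ take-++ʳ (suc N′) (nameFrom k l) _ ⟩
  nameFrom k l ++ k ∷ take N′ (nameFrom k′ r)
    ≡⟨ cong (λ ns → nameFrom k l ++ k ∷ ns) (take-nameFrom N′ k′ r N′≤) ⟩
  nameFrom k (node l (prefixTree N′ r)) ∎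
  where
  k′ = k + leaves l
  N′ = N ∸ leaves l
  N≡ = trans (sym (proj₁ (beyondLeft l r N≰l N≤))) (leaves+≡internal+suc l N′)
  N′≤ = proj₂ (beyondLeft l r N≰l N≤)

-- the tree that τ induces on its leaves after the first p
suffixTree : ℕ → Tree → Tree
suffixTree p leaf = leaf
suffixTree p (node l r) with p ≤? internal l
... | yes _ = node (suffixTree p l) r
... | no  _ = suffixTree (p ∸ leaves l) r

internal-suffixTree : ∀ p τ → p ≤ internal τ → internal (suffixTree p τ) + p ≡ internal τ
internal-suffixTree zero leaf _ = refl
internal-suffixTree p (node l r) p≤ with p ≤? internal l
... | yes p≤l = begin
  suc (internal (suffixTree p l) + internal r) + p ≡⟨ cong suc (xy∙z≈xz∙y (internal (suffixTree p l)) (internal r) p) ⟩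
  suc (internal (suffixTree p l) + p + internal r) ≡⟨ cong (λ i → suc (i + internal r)) (internal-suffixTree p l p≤l) ⟩
  internal (node l r) ∎
... | no  p≰l = begin
  internal (suffixTree p′ r) + p                  ≡⟨ cong (internal (suffixTree p′ r) +_) p≡ ⟩
  internal (suffixTree p′ r) + (internal l + suc p′) ≡⟨ cong (internal (suffixTree p′ r) +_) (+-suc (internal l) p′) ⟩
  internal (suffixTree p′ r) + suc (internal l + p′) ≡⟨ +-suc _ _ ⟩
  suc (internal (suffixTree p′ r) + (internal l + p′)) ≡⟨ cong suc (x∙yz≈y∙xz (internal (suffixTree p′ r)) (internal l) p′) ⟩
  suc (internal l + (internal (suffixTree p′ r) + p′)) ≡⟨ cong (λ i → suc (internal l + i)) (internal-suffixTree p′ r p′≤) ⟩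
  internal (node l r) ∎
  where
  p′ = p ∸ leaves l
  p≡ = trans (sym (proj₁ (beyondLeft l r p≰l p≤))) (leaves+≡internal+suc l p′)
  p′≤ = proj₂ (beyondLeft l r p≰l p≤)

leaves-suffixTree : ∀ p τ → p ≤ internal τ → p + leaves (suffixTree p τ) ≡ leaves τ
leaves-suffixTree p τ p≤ = begin
  p + leaves σ           ≡⟨ +-comm p _ ⟩
  leaves σ + p           ≡⟨ cong (_+ p) (leaves≡suc-internal σ) ⟩
  suc (internal σ + p)   ≡⟨ cong suc (internal-suffixTree p τ p≤) ⟩
  suc (internal τ)       ≡⟨ leaves≡suc-internal τ ⟨
  leaves τ               ∎
  where σ = suffixTree p τ

-- Entries pointing into the removed leaves now point to the new leftmost leaf.
drop-nameFrom : ∀ p k τ → p ≤ internal τ →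
  map ((k + p) ⊔_) (drop p (nameFrom k τ)) ≡ nameFrom (k + p) (suffixTree p τ)
drop-nameFrom zero k leaf _ = refl
drop-nameFrom p k (node l r) p≤ with p ≤? internal l
... | yes p≤l = begin
  map (q ⊔_) (drop p (nameFrom k l ++ k ∷ nameFrom k′ r))
    ≡⟨ cong (map (q ⊔_)) (drop-++ˡ p (nameFrom k l) _ (≤length-nameFrom k l p≤l)) ⟩
  map (q ⊔_) (drop p (nameFrom k l) ++ k ∷ nameFrom k′ r)
    ≡⟨ map-++ (q ⊔_) (drop p (nameFrom k l)) _ ⟩
  map (q ⊔_) (drop p (nameFrom k l)) ++ (q ⊔ k) ∷ map (q ⊔_) (nameFrom k′ r)
    ≡⟨ cong₂ _++_ (drop-nameFrom p k l p≤l) (cong₂ _∷_ (m≥n⇒m⊔n≡m (m≤m+n k p)) right-unchanged) ⟩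
  nameFrom q σ ++ q ∷ nameFrom k′ r
    ≡⟨ cong (λ i → nameFrom q σ ++ q ∷ nameFrom i r) leaves-σ ⟨
  nameFrom q (node σ r) ∎
  where
  q  = k + p
  k′ = k + leaves l
  σ  = suffixTree p l
  q≤k′ : q ≤ k′
  q≤k′ = +-monoʳ-≤ k (≤-trans p≤l (≤-trans (n≤1+n _) (≤-reflexive (sym (leaves≡suc-internal l)))))
  right-unchanged : map (q ⊔_) (nameFrom k′ r) ≡ nameFrom k′ r
  right-unchanged = map-id-local (All.map (m≤n⇒m⊔n≡n ∘ ≤-trans q≤k′) (nameFrom-≥ k′ r))
  leaves-σ : q + leaves σ ≡ k′
  leaves-σ = trans (+-assoc k p _) (cong (k +_) (leaves-suffixTree p l p≤l))
... | no p≰l = begin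
  map (q ⊔_) (drop p (nameFrom k l ++ k ∷ nameFrom k′ r))
    ≡⟨ cong (λ n → map (q ⊔_) (drop n (nameFrom k l ++ k ∷ nameFrom k′ r))) p≡ ⟩
  map (q ⊔_) (drop (length (nameFrom k l) + suc p′) (nameFrom k l ++ k ∷ nameFrom k′ r))
    ≡⟨ cong (map (q ⊔_)) (drop-++ʳ (suc p′) (nameFrom k l) _) ⟩
  map (q ⊔_) (drop p′ (nameFrom k′ r))
    ≡⟨ cong (λ i → map (i ⊔_) (drop p′ (nameFrom k′ r))) q≡ ⟨
  map ((k′ + p′) ⊔_) (drop p′ (nameFrom k′ r))
    ≡⟨ drop-nameFrom p′ k′ r p′≤ ⟩
  nameFrom (k′ + p′) (suffixTree p′ r)
    ≡⟨ cong (λ i → nameFrom i (suffixTree p′ r)) q≡ ⟩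
  nameFrom q (suffixTree p′ r) ∎
  where
  q  = k + p
  k′ = k + leaves l
  p′ = p ∸ leaves l
  p′≤ = proj₂ (beyondLeft l r p≰l p≤)
  q≡ : k′ + p′ ≡ q
  q≡ = trans (+-assoc k (leaves l) p′) (cong (k +_) (proj₁ (beyondLeft l r p≰l p≤)))
  p≡ : p ≡ length (nameFrom k l) + suc p′
  p≡ = trans (sym (proj₁ (beyondLeft l r p≰l p≤)))
             (trans (leaves+≡internal+suc l p′) (cong (_+ suc p′) (sym (length-nameFrom k l))))

IsName-length : ∀ {d t} → IsName d t → length t ≡ d
IsName-length (τ , refl , refl) = length-nameFrom 1 τ

IsName-positive : ∀ {d t} → IsName d t → All (1 ≤_) t
IsName-positive (τ , _ , refl) = nameFrom-≥ 1 τ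

IsName-take : ∀ {d t} p → p ≤ d → IsName d t → IsName p (take p t)
IsName-take p p≤d (τ , refl , refl) = prefixTree p τ , internal-prefixTree p τ p≤d , sym (take-nameFrom p 1 τ p≤d)

-- Names of positive degree have this shape; it is what lets _↗_, _↖_ and deg take
-- their generic clauses.
HeadPositive : List ℕ → Set
HeadPositive t = ∃₂ λ a as → t ≡ suc a ∷ as

headPositive : ∀ {t} → All (1 ≤_) t → 1 ≤ length t → HeadPositive t
headPositive {suc a ∷ as} _        _ = a , as , refl
headPositive {zero ∷ _}   (() ∷ _) _

IsName-headPositive : ∀ {d t} → 1 ≤ d → IsName d t → HeadPositive t
IsName-headPositive 1≤d t-name = headPositive (IsName-positive t-name) (subst (1 ≤_) (sym (IsName-length t-name)) 1≤d)

HeadPositive-++ : ∀ {u} x → HeadPositive u → HeadPositive (u ++ x)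
HeadPositive-++ x (a , as , refl) = a , as ++ x , refl

length-name : ∀ τ → 1 ≤ internal τ → length (name τ) ≡ internal τ
length-name τ 1≤ = trans (cong length (name≡nameFrom τ 1≤)) (length-nameFrom 1 τ)

PosName⇒IsName : ∀ {v} → PosName v → IsName (length v) v
PosName⇒IsName (τ , 1≤ , refl) = τ , sym (length-name τ 1≤) , sym (name≡nameFrom τ 1≤)

PosName-length : ∀ {v} → PosName v → 1 ≤ length v
PosName-length (τ , 1≤ , refl) = subst (1 ≤_) (sym (length-name τ 1≤)) 1≤

PosName-headPositive : ∀ {v} → PosName v → HeadPositive v
PosName-headPositive v-name = IsName-headPositive (PosName-length v-name) (PosName⇒IsName v-name)

-- Shifting names

infixr 6 _▷_

_▷_ : ℕ → List ℕ → List ℕ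
n ▷ w = map (n +̃_) w

shift : ℕ → List ℕ → List ℕ
shift n w = map (_+ n) w

-- y ↦ max (n + 1) y ∸ n inverts both n +̃_ and _+ n on positive numbers.
unshift : ℕ → ℕ → ℕ
unshift n y = (suc n ⊔ y) ∸ n

+̃≡+ : ∀ n {x} → 2 ≤ x → n +̃ x ≡ n + x
+̃≡+ n {suc (suc _)} _         = refl
+̃≡+ n {suc zero}    (s≤s ())

+̃-positive : ∀ n {x} → 1 ≤ x → 1 ≤ n +̃ x
+̃-positive n {suc zero}    _ = ≤-refl
+̃-positive n {suc (suc x)} _ = ≤-trans (s≤s z≤n) (m≤n+m (suc (suc x)) n)

+̃-mono : ∀ n {a b} → 1 ≤ a → a ≤ b → n +̃ a ≤ n +̃ b
+̃-mono n {suc zero}                  1≤a a≤b = +̃-positive n (≤-trans 1≤a a≤b)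
+̃-mono n {suc (suc a)} {suc (suc b)} _   a≤b = +-monoʳ-≤ n a≤b
+̃-mono n {suc (suc a)} {suc zero}    _   (s≤s ())

+̃-assoc : ∀ n m {x} → 1 ≤ x → n +̃ (m +̃ x) ≡ (n + m) +̃ x
+̃-assoc n m {suc zero}    _ = refl
+̃-assoc n m {suc (suc x)} _ =
  trans (+̃≡+ n (≤-trans (s≤s (s≤s z≤n)) (m≤n+m (suc (suc x)) m))) (sym (+-assoc n m (suc (suc x))))

unshift-mono : ∀ n {x y} → x ≤ y → unshift n x ≤ unshift n y
unshift-mono n x≤y = ∸-monoˡ-≤ n (⊔-monoʳ-≤ (suc n) x≤y)

unshift-+̃ : ∀ n {a} → 1 ≤ a → unshift n (n +̃ a) ≡ a
unshift-+̃ n {suc zero}    _ = trans (cong (_∸ n) (m≥n⇒m⊔n≡m (s≤s z≤n))) (m+n∸n≡m 1 n)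
unshift-+̃ n {suc (suc a)} _ = trans (cong (_∸ n) (m≤n⇒m⊔n≡n 1+n≤)) (m+n∸m≡n n (suc (suc a)))
  where
  1+n≤ : suc n ≤ n + suc (suc a)
  1+n≤ = subst (_≤ n + suc (suc a)) (+-comm n 1) (+-monoʳ-≤ n (s≤s z≤n))

unshift-+ : ∀ n {a} → 1 ≤ a → unshift n (a + n) ≡ a
unshift-+ n {a} 1≤a = trans (cong (_∸ n) (m≤n⇒m⊔n≡n (+-monoˡ-≤ n 1≤a))) (m+n∸n≡m a n)

+̃-unshift-≤ : ∀ n {y} → 1 ≤ y → n +̃ unshift n y ≤ y
+̃-unshift-≤ n {y} 1≤y with y ≤? suc n
... | yes y≤1+n = subst (λ z → n +̃ z ≤ y) (sym unshift≡1) 1≤y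
  where
  unshift≡1 : unshift n y ≡ 1
  unshift≡1 = trans (cong (_∸ n) (m≥n⇒m⊔n≡m y≤1+n)) (m+n∸n≡m 1 n)
... | no  y≰1+n = subst (λ z → n +̃ z ≤ y) (sym unshift≡) (≤-reflexive (trans (+̃≡+ n 2≤y∸n) (m+[n∸m]≡n n≤y)))
  where
  2+n≤y : suc (suc n) ≤ y
  2+n≤y = ≰⇒> y≰1+n
  n≤y : n ≤ y
  n≤y = ≤-trans (n≤1+n n) (≤-trans (n≤1+n (suc n)) 2+n≤y)
  unshift≡ : unshift n y ≡ y ∸ n
  unshift≡ = cong (_∸ n) (m≤n⇒m⊔n≡n (≤-trans (n≤1+n (suc n)) 2+n≤y))
  2≤y∸n : 2 ≤ y ∸ n
  2≤y∸n = subst (_≤ y ∸ n) (m+n∸n≡m 2 n) (∸-monoˡ-≤ n 2+n≤y)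

≤-unshift-+ : ∀ n y → y ≤ unshift n y + n
≤-unshift-+ n y = ≤-trans (m≤n⊔m (suc n) y) (≤-reflexive (sym (m∸n+n≡m (≤-trans (n≤1+n n) (m≤m⊔n (suc n) y)))))

All-▷ : ∀ n {w} → All (1 ≤_) w → All (1 ≤_) (n ▷ w)
All-▷ n = map⁺ ∘ All.map (+̃-positive n)

All-shift : ∀ n {w} → All (1 ≤_) w → All (1 ≤_) (shift n w)
All-shift n = map⁺ ∘ All.map (λ {x} 1≤x → ≤-trans 1≤x (m≤m+n x n))

▷-▷ : ∀ n m {w} → All (1 ≤_) w → n ▷ m ▷ w ≡ (n + m) ▷ w
▷-▷ n m {w} w⁺ = trans (sym (map-∘ w)) (map-cong-local (All.map (+̃-assoc n m) w⁺))

shift-shift : ∀ n m w → shift n (shift m w) ≡ shift (n + m) w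
shift-shift n m w = trans (sym (map-∘ w)) (map-cong (λ x → trans (+-assoc x m n) (cong (x +_) (+-comm m n))) w)

▷-mono : ∀ n {a b} → All (1 ≤_) a → a ≤⃗ b → (n ▷ a) ≤⃗ (n ▷ b)
▷-mono n []         []           = []
▷-mono n (1≤x ∷ ps) (x≤y ∷ x≤ys) = +̃-mono n 1≤x x≤y ∷ ▷-mono n ps x≤ys

shift-mono : ∀ n {a b} → a ≤⃗ b → shift n a ≤⃗ shift n b
shift-mono n = Pointwise.map⁺ _ _ ∘ Pointwise.map (+-monoˡ-≤ n)

unshift-mono⃗ : ∀ n {x y} → x ≤⃗ y → map (unshift n) x ≤⃗ map (unshift n) y
unshift-mono⃗ n = Pointwise.map⁺ _ _ ∘ Pointwise.map (unshift-mono n)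

unshift-▷ : ∀ n {a} → All (1 ≤_) a → map (unshift n) (n ▷ a) ≡ a
unshift-▷ n {a} a⁺ = trans (sym (map-∘ a)) (map-id-local (All.map (unshift-+̃ n) a⁺))

unshift-shift : ∀ n {a} → All (1 ≤_) a → map (unshift n) (shift n a) ≡ a
unshift-shift n {a} a⁺ = trans (sym (map-∘ a)) (map-id-local (All.map (unshift-+ n) a⁺))

▷-unshift-≤ : ∀ n {y} → All (1 ≤_) y → (n ▷ map (unshift n) y) ≤⃗ y
▷-unshift-≤ n []         = []
▷-unshift-≤ n (1≤y ∷ ps) = +̃-unshift-≤ n 1≤y ∷ ▷-unshift-≤ n ps

≤-shift-unshift : ∀ n y → y ≤⃗ shift n (map (unshift n) y)
≤-shift-unshift n []      = []
≤-shift-unshift n (y ∷ ys) = ≤-unshift-+ n y ∷ ≤-shift-unshift n ys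

unshift-between : ∀ n {lo hi y} → All (1 ≤_) lo → All (1 ≤_) hi → (n ▷ lo) ≤⃗ y → y ≤⃗ shift n hi →
  lo ≤⃗ map (unshift n) y × map (unshift n) y ≤⃗ hi
unshift-between n lo⁺ hi⁺ lower upper =
  subst (_≤⃗ _) (unshift-▷ n lo⁺) (unshift-mono⃗ n lower) , subst (_ ≤⃗_) (unshift-shift n hi⁺) (unshift-mono⃗ n upper)

IsName-unshift-drop : ∀ {q t} n → IsName (n + q) t → IsName q (map (unshift n) (drop n t))
IsName-unshift-drop {q} n (τ , internal≡ , refl) = σ , internal-σ , sym names≡
  where
  n≤ : n ≤ internal τ
  n≤ = subst (n ≤_) (sym internal≡) (m≤m+n n q)
  σ = suffixTree n τ
  internal-σ : internal σ ≡ q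
  internal-σ = +-cancelʳ-≡ n _ _ (trans (internal-suffixTree n τ n≤) (trans internal≡ (+-comm n q)))
  names≡ : map (unshift n) (drop n (nameFrom 1 τ)) ≡ nameFrom 1 σ
  names≡ = begin
    map (unshift n) (drop n (nameFrom 1 τ))               ≡⟨ map-∘ _ ⟩
    map (_∸ n) (map (suc n ⊔_) (drop n (nameFrom 1 τ)))  ≡⟨ cong (map (_∸ n)) (drop-nameFrom n 1 τ n≤) ⟩
    map (_∸ n) (nameFrom (suc n) σ)                       ≡⟨ cong (λ i → map (_∸ n) (nameFrom i σ)) (+-comm 1 n) ⟩
    map (_∸ n) (nameFrom (n + 1) σ)                       ≡⟨ cong (map (_∸ n)) (nameFrom-+ n 1 σ) ⟩
    map (_∸ n) (map (n +_) (nameFrom 1 σ))                ≡⟨ map-∘ _ ⟨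
    map (λ x → n + x ∸ n) (nameFrom 1 σ)                  ≡⟨ map-id-local (All.universal (m+n∸m≡n n) _) ⟩
    nameFrom 1 σ                                          ∎

module _ {A B : Set} {R : A → B → Set} where

  Pointwise-++ˡ⁻ : ∀ {a b t} p → length a ≡ p → Pointwise R (a ++ b) t →
    Pointwise R a (take p t) × Pointwise R b (drop p t)
  Pointwise-++ˡ⁻ {[]}    zero    _      rs       = [] , rs
  Pointwise-++ˡ⁻ {x ∷ a} (suc p) length≡ (r ∷ rs) = map₁ (r ∷_) (Pointwise-++ˡ⁻ p (suc-injective length≡) rs)

  Pointwise-++ʳ⁻ : ∀ {a b t} p → length a ≡ p → Pointwise R t (a ++ b) →
    Pointwise R (take p t) a × Pointwise R (drop p t) b
  Pointwise-++ʳ⁻ {[]}    zero    _      rs       = [] , rs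
  Pointwise-++ʳ⁻ {x ∷ a} (suc p) length≡ (r ∷ rs) = map₁ (r ∷_) (Pointwise-++ʳ⁻ p (suc-injective length≡) rs)

  Pointwise-++ˡ⁺ : ∀ {a b t} p → Pointwise R a (take p t) → Pointwise R b (drop p t) → Pointwise R (a ++ b) t
  Pointwise-++ˡ⁺ {t = t} p ra rb = subst (Pointwise R _) (take++drop≡id p t) (Pointwise.++⁺ ra rb)

  Pointwise-++ʳ⁺ : ∀ {a b t} p → Pointwise R (take p t) a → Pointwise R (drop p t) b → Pointwise R t (a ++ b)
  Pointwise-++ʳ⁺ {t = t} p ra rb = subst (λ t → Pointwise R t _) (take++drop≡id p t) (Pointwise.++⁺ ra rb)

≤⃗-refl : ∀ {t} → t ≤⃗ t
≤⃗-refl = Pointwiseₚ.refl ≤-refl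

≤⃗-trans : ∀ {x y z} → x ≤⃗ y → y ≤⃗ z → x ≤⃗ z
≤⃗-trans = transitive ≤-trans

≤⃗-antisym : ∀ {x y} → x ≤⃗ y → y ≤⃗ x → x ≡ y
≤⃗-antisym x≤y y≤x = Pointwise-≡⇒≡ (antisymmetric ≤-antisym x≤y y≤x)

-- Products of basis elements

starB-names : ∀ {s w p q} → length s ≡ p → length w ≡ q → HeadPositive s → HeadPositive w →
  starB s w ≡ interval (p + q) (s ++ p ▷ w) (s ++ shift p w)
starB-names refl refl (_ , _ , refl) (_ , _ , refl) = refl

-- In s ⋆ w every name begins with s, so t can only come from s = take p t.
sum-count-⋆ˡ : ∀ {lo hi w t p} → length lo ≡ p → length hi ≡ p → 1 ≤ p → HeadPositive w →
  sum (map (λ s → count (starB s w) t) (interval p lo hi))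
    ≡ count (interval (p + length w) (lo ++ p ▷ w) (hi ++ shift p w)) t
sum-count-⋆ˡ {lo} {hi} {w} {t} {p} |lo| |hi| 1≤p w⁺ = begin
  sum (map g (interval p lo hi))      ≡⟨ sum-map≡count* g s₀ _ onlyPrefix ⟩
  count (interval p lo hi) s₀ * g s₀
    ≡⟨ indicator-* (count-interval p lo hi s₀ 1≤p) fibre (count-interval d _ _ t 1≤d) split merge ⟩
  count (interval d (lo ++ p ▷ w) (hi ++ shift p w)) t ∎
  where
  d   = p + length w
  1≤d = ≤-trans 1≤p (m≤m+n p (length w))
  g   = λ s → count (starB s w) t
  s₀  = take p t
  starB-name : ∀ {s} → IsName p s → starB s w ≡ interval d (s ++ p ▷ w) (s ++ shift p w)
  starB-name s-name = starB-names (IsName-length s-name) refl (IsName-headPositive 1≤p s-name) w⁺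
  onlyPrefix : ∀ {s} → s ∈ interval p lo hi → g s ≢ 0 → s ≡ s₀
  onlyPrefix s∈ gs≢0 =
    ≤⃗-antisym (proj₁ (Pointwise-++ˡ⁻ p |s| lower)) (proj₁ (Pointwise-++ʳ⁻ p |s| upper))
    where
    s-name = ∈interval⇒IsName 1≤p s∈
    |s|    = IsName-length s-name
    inside = count≢0⇒InInterval 1≤d (subst (λ I → count I t ≢ 0) (starB-name s-name) gs≢0)
    lower  = proj₁ (proj₁ inside)
    upper  = proj₂ (proj₁ inside)
  fibre : InInterval p lo hi s₀ → Indicator (g s₀) (InInterval d (s₀ ++ p ▷ w) (s₀ ++ shift p w) t)
  fibre (_ , s₀-name) =
    subst (λ I → Indicator (count I t) (InInterval d (s₀ ++ p ▷ w) (s₀ ++ shift p w) t)) (sym (starB-name s₀-name))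
          (count-interval d _ _ t 1≤d)
  split : InInterval d (lo ++ p ▷ w) (hi ++ shift p w) t →
    InInterval p lo hi s₀ × InInterval d (s₀ ++ p ▷ w) (s₀ ++ shift p w) t
  split ((lower , upper) , t-name) =
    ((proj₁ lower′ , proj₁ upper′) , IsName-take p (m≤m+n p (length w)) t-name) ,
    (Pointwise-++ˡ⁺ p ≤⃗-refl (proj₂ lower′) , Pointwise-++ʳ⁺ p ≤⃗-refl (proj₂ upper′)) , t-name
    where
    lower′ = Pointwise-++ˡ⁻ p |lo| lower
    upper′ = Pointwise-++ʳ⁻ p |hi| upper
  merge : InInterval p lo hi s₀ × InInterval d (s₀ ++ p ▷ w) (s₀ ++ shift p w) t →
    InInterval d (lo ++ p ▷ w) (hi ++ shift p w) t
  merge (((lo≤ , ≤hi) , s₀-name) , (lower , upper) , t-name) =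
    (Pointwise-++ˡ⁺ p lo≤ (proj₂ (Pointwise-++ˡ⁻ p |s₀| lower)) ,
     Pointwise-++ʳ⁺ p ≤hi (proj₂ (Pointwise-++ʳ⁻ p |s₀| upper))) , t-name
    where |s₀| = IsName-length s₀-name

-- In u ⋆ s every name is u followed by an entry-wise shift of s, so t can only come
-- from s = unshift (drop n t).
sum-count-⋆ʳ : ∀ {u lo hi t n q} → HeadPositive u → length u ≡ n → 1 ≤ q → All (1 ≤_) lo → All (1 ≤_) hi →
  sum (map (λ s → count (starB u s) t) (interval q lo hi))
    ≡ count (interval (n + q) (u ++ n ▷ lo) (u ++ shift n hi)) t
sum-count-⋆ʳ {u} {lo} {hi} {t} {n} {q} u⁺ |u| 1≤q lo⁺ hi⁺ = begin
  sum (map g (interval q lo hi))      ≡⟨ sum-map≡count* g s₁ _ onlyUnshift ⟩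
  count (interval q lo hi) s₁ * g s₁
    ≡⟨ indicator-* (count-interval q lo hi s₁ 1≤q) fibre (count-interval d _ _ t 1≤d) split merge ⟩
  count (interval d (u ++ n ▷ lo) (u ++ shift n hi)) t ∎
  where
  d   = n + q
  1≤d = ≤-trans 1≤q (m≤n+m q n)
  g   = λ s → count (starB u s) t
  s₁  = map (unshift n) (drop n t)
  starB-name : ∀ {s} → IsName q s → starB u s ≡ interval d (u ++ n ▷ s) (u ++ shift n s)
  starB-name s-name = starB-names |u| (IsName-length s-name) u⁺ (IsName-headPositive 1≤q s-name)
  onlyUnshift : ∀ {s} → s ∈ interval q lo hi → g s ≢ 0 → s ≡ s₁
  onlyUnshift s∈ gs≢0 = ≤⃗-antisym (proj₁ between) (proj₂ between)
    where
    s-name  = ∈interval⇒IsName 1≤q s∈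
    s⁺      = IsName-positive s-name
    inside  = count≢0⇒InInterval 1≤d (subst (λ I → count I t ≢ 0) (starB-name s-name) gs≢0)
    between = unshift-between n s⁺ s⁺ (proj₂ (Pointwise-++ˡ⁻ n |u| (proj₁ (proj₁ inside))))
                                      (proj₂ (Pointwise-++ʳ⁻ n |u| (proj₂ (proj₁ inside))))
  fibre : InInterval q lo hi s₁ → Indicator (g s₁) (InInterval d (u ++ n ▷ s₁) (u ++ shift n s₁) t)
  fibre (_ , s₁-name) =
    subst (λ I → Indicator (count I t) (InInterval d (u ++ n ▷ s₁) (u ++ shift n s₁) t)) (sym (starB-name s₁-name))
          (count-interval d _ _ t 1≤d)
  split : InInterval d (u ++ n ▷ lo) (u ++ shift n hi) t →
    InInterval q lo hi s₁ × InInterval d (u ++ n ▷ s₁) (u ++ shift n s₁) t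
  split ((lower , upper) , t-name) =
    (unshift-between n lo⁺ hi⁺ (proj₂ lower′) (proj₂ upper′) , IsName-unshift-drop n t-name) ,
    (Pointwise-++ˡ⁺ n (proj₁ lower′) (▷-unshift-≤ n (drop⁺ n (IsName-positive t-name))) ,
     Pointwise-++ʳ⁺ n (proj₁ upper′) (≤-shift-unshift n (drop n t))) , t-name
    where
    lower′ = Pointwise-++ˡ⁻ n |u| lower
    upper′ = Pointwise-++ʳ⁻ n |u| upper
  merge : InInterval q lo hi s₁ × InInterval d (u ++ n ▷ s₁) (u ++ shift n s₁) t →
    InInterval d (u ++ n ▷ lo) (u ++ shift n hi) t
  merge (((lo≤ , ≤hi) , _) , (lower , upper) , t-name) =
    (Pointwise-++ˡ⁺ n (proj₁ lower′) (≤⃗-trans (▷-mono n lo⁺ lo≤) (proj₂ lower′)) ,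
     Pointwise-++ʳ⁺ n (proj₁ upper′) (≤⃗-trans (proj₂ upper′) (shift-mono n ≤hi))) , t-name
    where
    lower′ = Pointwise-++ˡ⁻ n |u| lower
    upper′ = Pointwise-++ʳ⁻ n |u| upper

length-++-map : ∀ (f : ℕ → ℕ) u v → length (u ++ map f v) ≡ length u + length v
length-++-map f u v = trans (length-++ u) (cong (length u +_) (length-map f v))

tripleInterval : List ℕ → List ℕ → List ℕ → List (List ℕ)
tripleInterval u v w = interval (n + m + length w) (u ++ n ▷ v ++ (n + m) ▷ w) (u ++ shift n v ++ shift (n + m) w)
  where
  n = length u
  m = length v

↗-unfold : ∀ {v w} → HeadPositive v → HeadPositive w → v ↗ w ≡ v ++ length v ▷ w
↗-unfold (_ , _ , refl) (_ , _ , refl) = refl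

↖-unfold : ∀ {v w} → HeadPositive v → HeadPositive w → v ↖ w ≡ v ++ shift (length v) w
↖-unfold (_ , _ , refl) (_ , _ , refl) = refl

deg-unfold : ∀ {v} → HeadPositive v → deg v ≡ length v
deg-unfold (_ , _ , refl) = refl

interval-↗↖≡tripleInterval : ∀ {u v w} → PosName u → PosName v → PosName w →
  interval (deg u + deg v + deg w) ((u ↗ v) ↗ w) ((u ↖ v) ↖ w) ≡ tripleInterval u v w
interval-↗↖≡tripleInterval {u} {v} {w} u-name v-name w-name =
  trans (cong (λ d → interval d ((u ↗ v) ↗ w) ((u ↖ v) ↖ w)) degree)
        (cong₂ (interval (n + m + length w)) lower upper)
  where
  u⁺ = PosName-headPositive u-name
  v⁺ = PosName-headPositive v-name
  w⁺ = PosName-headPositive w-name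
  n = length u
  m = length v
  degree : deg u + deg v + deg w ≡ n + m + length w
  degree = cong₂ _+_ (cong₂ _+_ (deg-unfold u⁺) (deg-unfold v⁺)) (deg-unfold w⁺)
  lower : (u ↗ v) ↗ w ≡ u ++ n ▷ v ++ (n + m) ▷ w
  lower = begin
    (u ↗ v) ↗ w                                    ≡⟨ cong (_↗ w) (↗-unfold u⁺ v⁺) ⟩
    (u ++ n ▷ v) ↗ w                               ≡⟨ ↗-unfold (HeadPositive-++ _ u⁺) w⁺ ⟩
    (u ++ n ▷ v) ++ length (u ++ n ▷ v) ▷ w
      ≡⟨ cong (λ i → (u ++ n ▷ v) ++ i ▷ w) (length-++-map (n +̃_) u v) ⟩
    (u ++ n ▷ v) ++ (n + m) ▷ w                    ≡⟨ ++-assoc u _ _ ⟩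
    u ++ n ▷ v ++ (n + m) ▷ w                      ∎
  upper : (u ↖ v) ↖ w ≡ u ++ shift n v ++ shift (n + m) w
  upper = begin
    (u ↖ v) ↖ w                                           ≡⟨ cong (_↖ w) (↖-unfold u⁺ v⁺) ⟩
    (u ++ shift n v) ↖ w                                  ≡⟨ ↖-unfold (HeadPositive-++ _ u⁺) w⁺ ⟩
    (u ++ shift n v) ++ shift (length (u ++ shift n v)) w
      ≡⟨ cong (λ i → (u ++ shift n v) ++ shift i w) (length-++-map (_+ n) u v) ⟩
    (u ++ shift n v) ++ shift (n + m) w                   ≡⟨ ++-assoc u _ _ ⟩
    u ++ shift n v ++ shift (n + m) w                     ∎

count⋆⋆ˡ : List ℕ → List ℕ → List ℕ → List ℕ → ℕ
count⋆⋆ˡ u v w t = sum (map (λ s → count (starB s w) t) (starB u v))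

count⋆⋆ʳ : List ℕ → List ℕ → List ℕ → List ℕ → ℕ
count⋆⋆ʳ u v w t = sum (map (λ s → count (starB u s) t) (starB v w))

count⋆⋆ˡ≡tripleInterval : ∀ {u v w} → PosName u → PosName v → PosName w → ∀ t →
  count⋆⋆ˡ u v w t ≡ count (tripleInterval u v w) t
count⋆⋆ˡ≡tripleInterval {u} {v} {w} u-name v-name w-name t = begin
  sum (map g (starB u v))
    ≡⟨ cong (sum ∘ map g) (starB-names refl refl (PosName-headPositive u-name) (PosName-headPositive v-name)) ⟩
  sum (map g (interval (n + m) (u ++ n ▷ v) (u ++ shift n v)))
    ≡⟨ sum-count-⋆ˡ (length-++-map (n +̃_) u v) (length-++-map (_+ n) u v) 1≤n+m (PosName-headPositive w-name) ⟩
  count (interval (n + m + length w) ((u ++ n ▷ v) ++ (n + m) ▷ w) ((u ++ shift n v) ++ shift (n + m) w)) t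
    ≡⟨ cong₂ (λ lo hi → count (interval (n + m + length w) lo hi) t) (++-assoc u _ _) (++-assoc u _ _) ⟩
  count (tripleInterval u v w) t ∎
  where
  n = length u
  m = length v
  g = λ s → count (starB s w) t
  1≤n+m = ≤-trans (PosName-length u-name) (m≤m+n n m)

count⋆⋆ʳ≡tripleInterval : ∀ {u v w} → PosName u → PosName v → PosName w → ∀ t →
  count⋆⋆ʳ u v w t ≡ count (tripleInterval u v w) t
count⋆⋆ʳ≡tripleInterval {u} {v} {w} u-name v-name w-name t = begin
  sum (map g (starB v w))
    ≡⟨ cong (sum ∘ map g) (starB-names refl refl (PosName-headPositive v-name) (PosName-headPositive w-name)) ⟩
  sum (map g (interval (m + k) (v ++ m ▷ w) (v ++ shift m w)))
    ≡⟨ sum-count-⋆ʳ (PosName-headPositive u-name) refl 1≤m+k (++⁺ v⁺ (All-▷ m w⁺)) (++⁺ v⁺ (All-shift m w⁺)) ⟩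
  count (interval (n + (m + k)) (u ++ n ▷ (v ++ m ▷ w)) (u ++ shift n (v ++ shift m w))) t
    ≡⟨ cong (λ d → count (interval d (u ++ n ▷ (v ++ m ▷ w)) (u ++ shift n (v ++ shift m w))) t) (+-assoc n m k) ⟨
  count (interval (n + m + k) (u ++ n ▷ (v ++ m ▷ w)) (u ++ shift n (v ++ shift m w))) t
    ≡⟨ cong₂ (λ lo hi → count (interval (n + m + k) lo hi) t) (cong (u ++_) lower) (cong (u ++_) upper) ⟩
  count (tripleInterval u v w) t ∎
  where
  n = length u
  m = length v
  k = length w
  v⁺ = IsName-positive (PosName⇒IsName v-name)
  w⁺ = IsName-positive (PosName⇒IsName w-name)
  g = λ s → count (starB u s) t
  1≤m+k = ≤-trans (PosName-length v-name) (m≤m+n m k)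
  lower : n ▷ (v ++ m ▷ w) ≡ n ▷ v ++ (n + m) ▷ w
  lower = trans (map-++ (n +̃_) v _) (cong (n ▷ v ++_) (▷-▷ n m w⁺))
  upper : shift n (v ++ shift m w) ≡ shift n v ++ shift (n + m) w
  upper = trans (map-++ (_+ n) v _) (cong (shift n v ++_) (shift-shift n m w))

count-interval-point : ∀ {d v} t → 1 ≤ d → IsName d v → count (interval d v v) t ≡ count (v ∷ []) t
count-interval-point {d} {v} t 1≤d v-name with count-interval d v v t 1≤d | ≡-dec _≟_ v t
... | inj₁ (c≡1 , _)             | yes _    = c≡1
... | inj₁ (_ , (v≤t , t≤v) , _) | no v≢t   = ⊥-elim (v≢t (≤⃗-antisym v≤t t≤v))
... | inj₂ (c≡0 , _)             | no _     = c≡0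
... | inj₂ (_ , outside)         | yes refl = ⊥-elim (outside ((≤⃗-refl , ≤⃗-refl) , v-name))

count-⋆-unitʳ : ∀ {v} → PosName v → ∀ t → count (starB v (0 ∷ [])) t ≡ count (v ∷ []) t
count-⋆-unitʳ {v} v-name t with PosName-headPositive v-name
... | _ , _ , refl = count-interval-point t (subst (1 ≤_) (sym (+-identityʳ _)) (PosName-length v-name))
                       (subst (λ d → IsName d v) (sym (+-identityʳ _)) (PosName⇒IsName v-name))

count-⋆-unitˡ : ∀ {v} → PosName v → ∀ t → count (starB (0 ∷ []) v) t ≡ count (v ∷ []) t
count-⋆-unitˡ {v} v-name t with PosName-headPositive v-name
... | _ , _ , refl = count-interval-point t (PosName-length v-name) (PosName⇒IsName v-name)

-- Coefficients in the free module

module Coefficients {c ℓ} (K : CommutativeRing c ℓ) where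

  open CommutativeRing K
    renaming (_+_ to _+ᴷ_; _*_ to _*ᴷ_; +-assoc to +ᴷ-assoc; +-identityʳ to +ᴷ-identityʳ;
              +-commutativeSemigroup to +ᴷ-commutativeSemigroup;
              refl to ≈-refl; sym to ≈-sym; trans to ≈-trans; reflexive to ≈-reflexive)
  open FreeModule K
  open import Algebra.Properties.CommutativeSemigroup +ᴷ-commutativeSemigroup using (interchange)
  open import Algebra.Properties.Monoid.Mult +-monoid using (×-homo-+) renaming (_×_ to _·_)

  ι : ℕ → Carrier
  ι n = n · 1#

  module _ {a} {A : Set a} where

    infixr 5 ∑
    ∑ : List A → (A → Carrier) → Carrier
    ∑ []       f = 0#
    ∑ (x ∷ xs) f = f x +ᴷ ∑ xs f

    syntax ∑ L (λ x → e) = ∑[ x ∈ L ] e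

    ∑-cong : ∀ L {f g : A → Carrier} → (∀ x → f x ≈ g x) → ∑ L f ≈ ∑ L g
    ∑-cong []      f≈g = ≈-refl
    ∑-cong (x ∷ L) f≈g = +-cong (f≈g x) (∑-cong L f≈g)

    ∑-cong-All : ∀ {p} {P : A → Set p} {L f g} → All P L → (∀ {x} → P x → f x ≈ g x) → ∑ L f ≈ ∑ L g
    ∑-cong-All []         f≈g = ≈-refl
    ∑-cong-All (px ∷ pxs) f≈g = +-cong (f≈g px) (∑-cong-All pxs f≈g)

    ∑-++ : ∀ L M f → ∑ (L ++ M) f ≈ ∑ L f +ᴷ ∑ M f
    ∑-++ []      M f = ≈-sym (+-identityˡ _)
    ∑-++ (x ∷ L) M f = ≈-trans (+-congˡ (∑-++ L M f)) (≈-sym (+ᴷ-assoc _ _ _))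

    ∑-0 : ∀ L → ∑ L (λ _ → 0#) ≈ 0#
    ∑-0 []      = ≈-refl
    ∑-0 (x ∷ L) = ≈-trans (+-identityˡ _) (∑-0 L)

    ∑-+ : ∀ L f g → ∑ L f +ᴷ ∑ L g ≈ ∑ L (λ x → f x +ᴷ g x)
    ∑-+ []      f g = +-identityˡ _
    ∑-+ (x ∷ L) f g = ≈-trans (interchange _ _ _ _) (+-congˡ (∑-+ L f g))

    ∑-*ˡ : ∀ L k f → ∑ L (λ x → k *ᴷ f x) ≈ k *ᴷ ∑ L f
    ∑-*ˡ []      k f = ≈-sym (zeroʳ k)
    ∑-*ˡ (x ∷ L) k f = ≈-trans (+-congˡ (∑-*ˡ L k f)) (≈-sym (distribˡ k _ _))

    coeff-concatMap : ∀ (g : A → Comb) L t → coeff (concatMap g L) t ≈ ∑ L (λ x → coeff (g x) t)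
    coeff-concatMap g []      t = ≈-refl
    coeff-concatMap g (x ∷ L) t = ≈-trans (coeff-++ (g x) (concatMap g L) t) (+-congˡ (coeff-concatMap g L t))
      where
      coeff-++ : ∀ X Y t → coeff (X ++ Y) t ≈ coeff X t +ᴷ coeff Y t
      coeff-++ []            Y t = ≈-sym (+-identityˡ _)
      coeff-++ ((a , s) ∷ X) Y t with ≡-dec _≟_ s t
      ... | yes _ = ≈-trans (+-congˡ (coeff-++ X Y t)) (≈-sym (+ᴷ-assoc _ _ _))
      ... | no  _ = coeff-++ X Y t

  module _ {a b} {A : Set a} {B : Set b} where

    ∑-swap : ∀ (L : List A) (M : List B) (F : A → B → Carrier) →
      ∑[ x ∈ L ] ∑[ y ∈ M ] F x y ≈ ∑[ y ∈ M ] ∑[ x ∈ L ] F x y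
    ∑-swap []      M F = ≈-sym (∑-0 M)
    ∑-swap (x ∷ L) M F = ≈-trans (+-congˡ (∑-swap L M F)) (∑-+ M (F x) (λ y → ∑[ x ∈ L ] F x y))

    ∑-concatMap : ∀ (g : A → List B) L f → ∑ (concatMap g L) f ≈ ∑[ x ∈ L ] ∑ (g x) f
    ∑-concatMap g []      f = ≈-refl
    ∑-concatMap g (x ∷ L) f = ≈-trans (∑-++ (g x) (concatMap g L) f) (+-congˡ (∑-concatMap g L f))

    ∑-map : ∀ (h : A → B) L f → ∑ (map h L) f ≈ ∑[ x ∈ L ] f (h x)
    ∑-map h []      f = ≈-refl
    ∑-map h (x ∷ L) f = +-congˡ (∑-map h L f)

  ∑-ι : ∀ L (g : List ℕ → ℕ) → ∑[ s ∈ L ] ι (g s) ≈ ι (sum (map g L))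
  ∑-ι []      g = ≈-refl
  ∑-ι (s ∷ L) g = ≈-trans (+-congˡ (∑-ι L g)) (≈-sym (×-homo-+ 1# (g s) _))

  coeff-scaled : ∀ k L t → coeff (map (k ,_) L) t ≈ k *ᴷ ι (count L t)
  coeff-scaled k []      t = ≈-sym (zeroʳ k)
  coeff-scaled k (s ∷ L) t with ≡-dec _≟_ s t
  ... | yes _ = ≈-trans (+-cong (≈-sym (*-identityʳ k)) (coeff-scaled k L t)) (≈-sym (distribˡ k 1# _))
  ... | no  _ = coeff-scaled k L t

  coeff-sumB : ∀ L t → coeff (sumB L) t ≈ ι (count L t)
  coeff-sumB L t = ≈-trans (coeff-scaled 1# L t) (*-identityˡ _)

  sumB-≋ : ∀ L M → (∀ t → count L t ≡ count M t) → sumB L ≋ sumB M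
  sumB-≋ L M counts t =
    ≈-trans (coeff-sumB L t) (≈-trans (≈-reflexive (cong ι (counts t))) (≈-sym (coeff-sumB M t)))

  productCoeff : List ℕ → Carrier × List ℕ → Carrier × List ℕ → Carrier
  productCoeff t (a , v) (b , w) = (a *ᴷ b) *ᴷ ι (count (starB v w) t)

  coeff-⋆ : ∀ x y t → coeff (x ⋆ y) t ≈ ∑[ p ∈ x ] ∑[ q ∈ y ] productCoeff t p q
  coeff-⋆ x y t = ≈-trans (coeff-concatMap _ x t) (∑-cong x λ p →
    ≈-trans (coeff-concatMap _ y t) (∑-cong y λ q → coeff-scaled (proj₁ p *ᴷ proj₁ q) (starB (proj₂ p) (proj₂ q)) t))

  ∑-⋆ : ∀ x y (F : Carrier × List ℕ → Carrier) →
    ∑ (x ⋆ y) F ≈ ∑[ p ∈ x ] ∑[ q ∈ y ] ∑[ s ∈ starB (proj₂ p) (proj₂ q) ] F (proj₁ p *ᴷ proj₁ q , s)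
  ∑-⋆ x y F = ≈-trans (∑-concatMap _ x F) (∑-cong x λ p →
    ≈-trans (∑-concatMap _ y F) (∑-cong y λ q → ∑-map _ (starB (proj₂ p) (proj₂ q)) F))

  coeff-⋆⋆ˡ : ∀ x y z t → coeff ((x ⋆ y) ⋆ z) t ≈
    ∑[ p ∈ x ] ∑[ q ∈ y ] ∑[ r ∈ z ]
      ((proj₁ p *ᴷ proj₁ q) *ᴷ proj₁ r) *ᴷ ι (count⋆⋆ˡ (proj₂ p) (proj₂ q) (proj₂ r) t)
  coeff-⋆⋆ˡ x y z t =
    ≈-trans (coeff-⋆ (x ⋆ y) z t) (≈-trans (∑-⋆ x y (λ e → ∑[ r ∈ z ] productCoeff t e r))
      (∑-cong x λ p → ∑-cong y λ q →
      ≈-trans (∑-swap (starB (proj₂ p) (proj₂ q)) z _) (∑-cong z λ r →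
        ≈-trans (∑-*ˡ (starB (proj₂ p) (proj₂ q)) _ _) (*-congˡ (∑-ι (starB (proj₂ p) (proj₂ q)) _)))))

  coeff-⋆⋆ʳ : ∀ x y z t → coeff (x ⋆ (y ⋆ z)) t ≈
    ∑[ p ∈ x ] ∑[ q ∈ y ] ∑[ r ∈ z ]
      (proj₁ p *ᴷ (proj₁ q *ᴷ proj₁ r)) *ᴷ ι (count⋆⋆ʳ (proj₂ p) (proj₂ q) (proj₂ r) t)
  coeff-⋆⋆ʳ x y z t =
    ≈-trans (coeff-⋆ x (y ⋆ z) t) (∑-cong x λ p →
      ≈-trans (∑-⋆ y z (productCoeff t p)) (∑-cong y λ q → ∑-cong z λ r →
      ≈-trans (∑-*ˡ (starB (proj₂ q) (proj₂ r)) _ _) (*-congˡ (∑-ι (starB (proj₂ q) (proj₂ r)) _))))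

  ⋆-assoc-on : ∀ {p} {Q : List ℕ → Set p} →
    (∀ {u v w} → Q u → Q v → Q w → ∀ t → count⋆⋆ˡ u v w t ≡ count⋆⋆ʳ u v w t) →
    ∀ x y z → All (Q ∘ proj₂) x → All (Q ∘ proj₂) y → All (Q ∘ proj₂) z → ((x ⋆ y) ⋆ z) ≋ (x ⋆ (y ⋆ z))
  ⋆-assoc-on counts x y z x-Q y-Q z-Q t =
    ≈-trans (coeff-⋆⋆ˡ x y z t) (≈-trans
      (∑-cong-All x-Q λ p-Q → ∑-cong-All y-Q λ q-Q → ∑-cong-All z-Q λ r-Q →
         *-cong (*-assoc _ _ _) (≈-reflexive (cong ι (counts p-Q q-Q r-Q t))))
      (≈-sym (coeff-⋆⋆ʳ x y z t)))

  basis-⋆⋆ : ∀ u v w L → (∀ t → count⋆⋆ˡ u v w t ≡ count L t) → ((basis u ⋆ basis v) ⋆ basis w) ≋ sumB L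
  basis-⋆⋆ u v w L counts t =
    ≈-trans (coeff-⋆⋆ˡ (basis u) (basis v) (basis w) t)
    (≈-trans (+ᴷ-identityʳ _) (≈-trans (+ᴷ-identityʳ _) (≈-trans (+ᴷ-identityʳ _)
    (≈-trans (*-congʳ (≈-trans (*-identityʳ _) (*-identityˡ _)))
    (≈-trans (*-identityˡ _) (≈-trans (≈-reflexive (cong ι (counts t))) (≈-sym (coeff-sumB L t))))))))

proposition3p5 : {c ℓ : Level} (K : CommutativeRing c ℓ) → IsCharZeroField K →
    let open FreeModule K in
    (∀ (x y z : Comb) → InSpace x → InSpace y → InSpace z →
        ((x ⋆ y) ⋆ z) ≋ (x ⋆ (y ⋆ z)))
    × (∀ (u v w : List ℕ) → PosName u → PosName v → PosName w →
        ((basis u ⋆ basis v) ⋆ basis w)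
          ≋ sumB (interval (deg u + deg v + deg w) ((u ↗ v) ↗ w) ((u ↖ v) ↖ w)))
    × (∀ (v : List ℕ) → PosName v →
        (sumB (starB v (0 ∷ [])) ≋ basis v) × (sumB (starB (0 ∷ []) v) ≋ basis v))
proposition3p5 K _ =
  ⋆-assoc-on (λ u v w t → trans (count⋆⋆ˡ≡tripleInterval u v w t) (sym (count⋆⋆ʳ≡tripleInterval u v w t))) ,
  (λ u v w u-name v-name w-name →
     basis-⋆⋆ u v w (interval (deg u + deg v + deg w) ((u ↗ v) ↗ w) ((u ↖ v) ↖ w)) λ t →
       trans (count⋆⋆ˡ≡tripleInterval u-name v-name w-name t)
             (cong (λ I → count I t) (sym (interval-↗↖≡tripleInterval u-name v-name w-name)))) ,
  (λ v v-name → sumB-≋ (starB v (0 ∷ [])) (v ∷ []) (count-⋆-unitʳ v-name) ,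
                sumB-≋ (starB (0 ∷ []) v) (v ∷ []) (count-⋆-unitˡ v-name))
  where open Coefficients K
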